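{- Let $p$ be an odd prime and for $n\in\mathbb{N}$ let $S_n=\sum_{k=0}^n\binom nk\binom{n+k}k\frac1{k+1}$. Then $$\sum_{k=1}^{p-1}S_k\equiv2\left(\frac{ -1}p\right)-2^p\pmod {p^2}.$$
   Context: $\left(\frac{\cdot}{p}\right)$ denotes the Legendre symbol. -}

module Defs where

open import Data.Nat as ℕ using (ℕ; zero; suc; _≡ᵇ_)
open import Data.Nat.Combinatorics using (_C_)
open import Data.Nat.DivMod using (_/_; _%_)
open import Data.Integer as ℤ using (ℤ; +_)
open import Data.Integer.DivMod using (_%ℕ_)
open import Data.List using (List; upTo)
open import Data.Bool.ListAction using (any)
open import Data.Bool using (if_then_else_)

sumTo : ℕ → (ℕ → ℕ) → ℕ
sumTo zero    f = f 0
sumTo (suc n) f = sumTo n f ℕ.+ f (suc n)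

sumFrom1 : ℕ → (ℕ → ℕ) → ℕ
sumFrom1 zero    f = 0
sumFrom1 (suc n) f = sumFrom1 n f ℕ.+ f (suc n)

-- S_n = Σ_{k=0}^n C(n,k) C(n+k,k) / (k+1).
-- Each summand is an integer (C(n,k)C(n+k,k) = C(n+k,2k)·C(2k,k) and
-- (k+1) ∣ C(2k,k)), so the natural-number division below is exact.
S : ℕ → ℕ
S n = sumTo n (λ k → ((n C k) ℕ.* ((n ℕ.+ k) C k)) / suc k)

legendre : ℤ → (p : ℕ) → .{{_ : ℕ.NonZero p}} → ℤ
legendre a p with a %ℕ p
... | zero  = + 0
... | suc r = if any (λ x → ((x ℕ.* x) % p) ≡ᵇ suc r) (upTo p)
                then + 1 else ℤ.- (+ 1)

-- Split each summand of S n as C_k · C(n+k, 2k), with C_k the k-th Catalan number, and sum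
-- over n < p with the hockey-stick identity: Σ_{n<p} S n = Σ_{k<p} τ p k, where
-- τ p k = C_k · C(p+k, 2k+1) satisfies (2k+1) · τ p k = C(p+k, k) · C(p, k+1).
-- Write p = 2h+1 and work modulo p². Since C(p+k, k) ≡ 1 (mod p) and
-- (k+1) · C(p, k+1) ≡ (−1)^k p (mod p²), the terms k and 2h−k pair up to −(C(p,k) + C(p,k+1)),
-- the middle term is τ p h ≡ 2(−1)^h (1 − p), and C(p, h) ≡ 2(−1)^h p; half of the binomial
-- row then collapses the sum to 2(−1)^h + 1 − 2^p, and S 0 = 1 accounts for the last 1.
-- Finally (−1/p) = (−1)^h: by Wilson's theorem (h!)² ≡ −(−1)^h, a square root of −1 when h
-- is even, while for odd h a square root x of −1 would give x^(p−1) ≡ −1, against Fermat.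

module Submission where

open import Algebra.Core using (Op₂)
open import Algebra.Structures using (IsCommutativeMonoid)
open import Data.Empty using (⊥; ⊥-elim)
open import Data.Integer as ℤ using (ℤ; +_; -[1+_]; ∣_∣; 0ℤ; 1ℤ; -1ℤ)
import Data.Integer.Properties as ℤ
open import Data.Nat as ℕ using (ℕ; zero; suc; _≤_; _<_; z≤n; s≤s; _!)
open import Data.Nat.Combinatorics
  using (_C_; nCk≡n!/k![n-k]!; k![n∸k]!∣n!; k>n⇒nCk≡0; nCk≡nC[n∸k]; nCk+nC[k+1]≡[n+1]C[k+1]; nCn≡1; nC1≡n)
import Data.Nat.Divisibility as ℕ
open import Data.Nat.Primality using (Prime; euclidsLemma; prime⇒nonZero; prime⇒nonTrivial)
import Data.Nat.Properties as ℕ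
open import Data.Product using (Σ-syntax; _,_; proj₁; proj₂)
open import Data.Sum using (_⊎_; inj₁; inj₂)
open import Function using (_∘′_)
open import Relation.Nullary using (¬_)
open import Relation.Binary.PropositionalEquality
open import Defs

module Congruence where

  open import Data.Integer using (_+_; _*_; -_; _-_)
  open import Data.Integer.Tactic.RingSolver using (solve-∀)
  open import Relation.Binary.Bundles using (Setoid)
  open import Relation.Binary.Structures using (IsEquivalence)

  infix 4 _≡_mod_

  record _≡_mod_ (a b m : ℤ) : Set where
    constructor ≡-mod
    field
      quotient : ℤ
      equation : a ≡ b + quotient * m

  module _ {m : ℤ} where

    mod-refl : ∀ {a} → a ≡ a mod m
    mod-refl {a} = ≡-mod (+ 0) (identity a m)
      where identity : ∀ a m → a ≡ a + + 0 * m
            identity = solve-∀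

    mod-reflexive : ∀ {a b} → a ≡ b → a ≡ b mod m
    mod-reflexive refl = mod-refl

    mod-sym : ∀ {a b} → a ≡ b mod m → b ≡ a mod m
    mod-sym {b = b} (≡-mod q refl) = ≡-mod (- q) (identity b q m)
      where identity : ∀ b q m → b ≡ (b + q * m) + (- q) * m
            identity = solve-∀

    mod-trans : ∀ {a b c} → a ≡ b mod m → b ≡ c mod m → a ≡ c mod m
    mod-trans {c = c} (≡-mod q refl) (≡-mod r refl) = ≡-mod (r + q) (identity c r q m)
      where identity : ∀ c r q m → c + r * m + q * m ≡ c + (r + q) * m
            identity = solve-∀

    +-cong : ∀ {a b c d} → a ≡ b mod m → c ≡ d mod m → a + c ≡ b + d mod m
    +-cong {b = b} {d = d} (≡-mod q refl) (≡-mod r refl) = ≡-mod (q + r) (identity b d q r m)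
      where identity : ∀ b d q r m → b + q * m + (d + r * m) ≡ b + d + (q + r) * m
            identity = solve-∀

    -‿cong : ∀ {a b} → a ≡ b mod m → - a ≡ - b mod m
    -‿cong {b = b} (≡-mod q refl) = ≡-mod (- q) (identity b q m)
      where identity : ∀ b q m → - (b + q * m) ≡ - b + (- q) * m
            identity = solve-∀

    sub-cong : ∀ {a b c d} → a ≡ b mod m → c ≡ d mod m → a - c ≡ b - d mod m
    sub-cong a≡b c≡d = +-cong a≡b (-‿cong c≡d)

    *-cong : ∀ {a b c d} → a ≡ b mod m → c ≡ d mod m → a * c ≡ b * d mod m
    *-cong {b = b} {d = d} (≡-mod q refl) (≡-mod r refl) =
      ≡-mod (q * d + b * r + q * r * m) (identity b d q r m)
      where identity : ∀ b d q r m → (b + q * m) * (d + r * m) ≡ b * d + (q * d + b * r + q * r * m) * m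
            identity = solve-∀

    *-congˡ : ∀ c {a b} → a ≡ b mod m → c * a ≡ c * b mod m
    *-congˡ c = *-cong (mod-refl {c})

    *-congʳ : ∀ c {a b} → a ≡ b mod m → a * c ≡ b * c mod m
    *-congʳ c a≡b = *-cong a≡b (mod-refl {c})

    multiple≡0 : ∀ x → x * m ≡ 0ℤ mod m
    multiple≡0 x = ≡-mod x (sym (ℤ.+-identityˡ (x * m)))

    mod-isEquivalence : IsEquivalence (_≡_mod m)
    mod-isEquivalence = record { refl = mod-refl ; sym = mod-sym ; trans = mod-trans }

  mod-setoid : ℤ → Setoid _ _
  mod-setoid m = record { isEquivalence = mod-isEquivalence {m} }

  module ≡-mod-Reasoning (m : ℤ) where
    open import Relation.Binary.Reasoning.Setoid (mod-setoid m) public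

  mod-divisor : ∀ {m n a b} → a ≡ b mod (m * n) → a ≡ b mod m
  mod-divisor {m} {n} {b = b} (≡-mod q refl) = ≡-mod (q * n) (identity b q m n)
    where identity : ∀ b q m n → b + q * (m * n) ≡ b + q * n * m
          identity = solve-∀

  *-cong-scaled : ∀ c {m a b} → a ≡ b mod m → c * a ≡ c * b mod (c * m)
  *-cong-scaled c {m} {b = b} (≡-mod q refl) = ≡-mod q (identity b q m c)
    where identity : ∀ b q m c → c * (b + q * m) ≡ c * b + q * (c * m)
          identity = solve-∀

  ≡0-mod⇒∣ : ∀ {a m} → a ≡ 0ℤ mod m → ∣ m ∣ ℕ.∣ ∣ a ∣
  ≡0-mod⇒∣ {m = m} (≡-mod q refl) =
    ℕ.divides ∣ q ∣ (trans (cong ∣_∣ (ℤ.+-identityˡ (q * m))) (ℤ.abs-* q m))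

  module _ {p : ℕ} (prime : Prime p) where

    private
      multiple-of-p : ∀ x n → ∣ x ∣ ≡ n ℕ.* p → Σ[ z ∈ ℤ ] x ≡ z * + p
      multiple-of-p (+ _)     n e = + n , trans (cong +_ e) (ℤ.pos-* n p)
      multiple-of-p -[1+ _ ]  n e =
        - + n , trans (cong (-_ ∘′ +_) e) (trans (cong -_ (ℤ.pos-* n p)) (ℤ.neg-distribˡ-* (+ n) (+ p)))

      euclid : ∀ c x q → ¬ p ℕ.∣ ∣ c ∣ → c * x ≡ q * + p → Σ[ z ∈ ℤ ] x ≡ z * + p
      euclid c x q p∤c e
        with euclidsLemma ∣ c ∣ ∣ x ∣ prime
               (ℕ.divides ∣ q ∣ (trans (sym (ℤ.abs-* c x)) (trans (cong ∣_∣ e) (ℤ.abs-* q (+ p)))))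
      ... | inj₁ p∣c = ⊥-elim (p∤c p∣c)
      ... | inj₂ (ℕ.divides n e′) = multiple-of-p x n e′

      difference : ∀ c a b q m → c * a ≡ c * b + q * m → c * (a - b) ≡ q * m
      difference c a b q m e = trans (identity₁ c a b) (trans (cong (_- c * b) e) (identity₂ (c * b) q m))
        where identity₁ : ∀ c a b → c * (a - b) ≡ c * a - c * b
              identity₁ = solve-∀
              identity₂ : ∀ u q m → u + q * m - u ≡ q * m
              identity₂ = solve-∀

      from-difference : ∀ a b z m → a - b ≡ z * m → a ≡ b mod m
      from-difference a b z m e = ≡-mod z (trans (identity a b) (cong (λ x → b + x) e))
        where identity : ∀ a b → a ≡ b + (a - b)
              identity = solve-∀

    *-cancelˡ-mod-prime : ∀ {c a b} → ¬ p ℕ.∣ ∣ c ∣ → c * a ≡ c * b mod + p → a ≡ b mod + p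
    *-cancelˡ-mod-prime {c} {a} {b} p∤c (≡-mod q e)
      with euclid c (a - b) q p∤c (difference c a b q (+ p) e)
    ... | z , a-b≡zp = from-difference a b z (+ p) a-b≡zp

    -- Euclid's lemma is applied twice: first to c (a − b), then to c (a − b) / p.
    *-cancelˡ-mod-prime² : ∀ {c a b} → ¬ p ℕ.∣ ∣ c ∣ → c * a ≡ c * b mod (+ p * + p) → a ≡ b mod (+ p * + p)
    *-cancelˡ-mod-prime² {c} {a} {b} p∤c (≡-mod q e) =
      from-difference a b z _ (trans a-b≡yp (trans (cong (_* + p) y≡zp) (ℤ.*-assoc z (+ p) (+ p))))
      where
      c[a-b]≡qpp : c * (a - b) ≡ q * + p * + p
      c[a-b]≡qpp = trans (difference c a b q _ e) (sym (ℤ.*-assoc q (+ p) (+ p)))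
      y : ℤ
      y = proj₁ (euclid c (a - b) (q * + p) p∤c c[a-b]≡qpp)
      a-b≡yp : a - b ≡ y * + p
      a-b≡yp = proj₂ (euclid c (a - b) (q * + p) p∤c c[a-b]≡qpp)
      cyp≡qpp : c * y * + p ≡ q * + p * + p
      cyp≡qpp = trans (ℤ.*-assoc c y (+ p)) (trans (cong (c *_) (sym a-b≡yp)) c[a-b]≡qpp)
      cy≡qp : c * y ≡ q * + p
      cy≡qp = ℤ.*-cancelʳ-≡ (c * y) (q * + p) (+ p) {{prime⇒nonZero prime}} cyp≡qpp
      z : ℤ
      z = proj₁ (euclid c y q p∤c cy≡qp)
      y≡zp : y ≡ z * + p
      y≡zp = proj₂ (euclid c y q p∤c cy≡qp)

  ≡1*≡0-mod² : ∀ {m a b} → a ≡ 1ℤ mod m → b ≡ 0ℤ mod m → a * b ≡ b mod (m * m)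
  ≡1*≡0-mod² {m} (≡-mod q refl) (≡-mod r refl) = ≡-mod (q * r) (identity q r m)
    where identity : ∀ q r m → (1ℤ + q * m) * (0ℤ + r * m) ≡ 0ℤ + r * m + q * r * (m * m)
          identity = solve-∀

  -- 1 − m u is an inverse of 1 + m u modulo m².
  *-cancel-1+mu : ∀ m u {a c} → (1ℤ + m * u) * a ≡ c mod (m * m) → a ≡ c - m * u * c mod (m * m)
  *-cancel-1+mu m u {a} {c} (≡-mod q e) = ≡-mod (q - m * u * q + u * u * a) (begin
    a                                           ≡⟨ identity₁ m u a ⟩
    (1ℤ - m * u) * ((1ℤ + m * u) * a) + u * u * a * (m * m)  ≡⟨ cong (λ x → (1ℤ - m * u) * x + u * u * a * (m * m)) e ⟩
    (1ℤ - m * u) * (c + q * (m * m)) + u * u * a * (m * m)   ≡⟨ identity₂ m u a c q ⟩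
    c - m * u * c + (q - m * u * q + u * u * a) * (m * m)    ∎)
    where
    open ≡-Reasoning
    identity₁ : ∀ m u a → a ≡ (1ℤ - m * u) * ((1ℤ + m * u) * a) + u * u * a * (m * m)
    identity₁ = solve-∀
    identity₂ : ∀ m u a c q → (1ℤ - m * u) * (c + q * (m * m)) + u * u * a * (m * m) ≡ c - m * u * c + (q - m * u * q + u * u * a) * (m * m)
    identity₂ = solve-∀

  ^-cong : ∀ {m a b} k → a ≡ b mod m → a ℤ.^ k ≡ b ℤ.^ k mod m
  ^-cong zero    a≡b = mod-refl
  ^-cong (suc k) a≡b = *-cong a≡b (^-cong k a≡b)

open Congruence

module RangeFold {A : Set} {_∙_ : Op₂ A} {ε : A} (isCommutativeMonoid : IsCommutativeMonoid _≡_ _∙_ ε) where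

  open import Data.Nat using (_+_; _∸_)

  open IsCommutativeMonoid isCommutativeMonoid using (assoc; comm; identityˡ; identityʳ)
  open ≡-Reasoning

  ⨁ : ℕ → (ℕ → A) → A
  ⨁ zero    f = ε
  ⨁ (suc n) f = ⨁ n f ∙ f n

  ⨁-cong : ∀ n {f g} → (∀ i → i < n → f i ≡ g i) → ⨁ n f ≡ ⨁ n g
  ⨁-cong zero    f≡g = refl
  ⨁-cong (suc n) f≡g = cong₂ _∙_ (⨁-cong n (λ i i<n → f≡g i (ℕ.m<n⇒m<1+n i<n))) (f≡g n ℕ.≤-refl)

  ⨁-ε : ∀ n → ⨁ n (λ _ → ε) ≡ ε
  ⨁-ε zero    = refl
  ⨁-ε (suc n) = trans (identityʳ _) (⨁-ε n)

  private
    medial : ∀ a b c d → (a ∙ b) ∙ (c ∙ d) ≡ (a ∙ c) ∙ (b ∙ d)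
    medial a b c d = begin
      (a ∙ b) ∙ (c ∙ d) ≡⟨ assoc a b (c ∙ d) ⟩
      a ∙ (b ∙ (c ∙ d)) ≡⟨ cong (a ∙_) (assoc b c d) ⟨
      a ∙ ((b ∙ c) ∙ d) ≡⟨ cong (λ x → a ∙ (x ∙ d)) (comm b c) ⟩
      a ∙ ((c ∙ b) ∙ d) ≡⟨ cong (a ∙_) (assoc c b d) ⟩
      a ∙ (c ∙ (b ∙ d)) ≡⟨ assoc a c (b ∙ d) ⟨
      (a ∙ c) ∙ (b ∙ d) ∎

  ⨁-distrib : ∀ n (f g : ℕ → A) → ⨁ n (λ i → f i ∙ g i) ≡ ⨁ n f ∙ ⨁ n g
  ⨁-distrib zero    f g = sym (identityˡ ε)
  ⨁-distrib (suc n) f g = trans (cong (_∙ (f n ∙ g n)) (⨁-distrib n f g)) (medial _ _ _ _)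

  ⨁-head : ∀ n (f : ℕ → A) → ⨁ (suc n) f ≡ f 0 ∙ ⨁ n (λ i → f (suc i))
  ⨁-head zero    f = trans (identityˡ (f 0)) (sym (identityʳ (f 0)))
  ⨁-head (suc n) f = trans (cong (_∙ f (suc n)) (⨁-head n f)) (assoc _ _ _)

  ⨁-+ : ∀ m n (f : ℕ → A) → ⨁ (m + n) f ≡ ⨁ m f ∙ ⨁ n (λ i → f (m + i))
  ⨁-+ m zero    f = trans (cong (λ k → ⨁ k f) (ℕ.+-identityʳ m)) (sym (identityʳ _))
  ⨁-+ m (suc n) f = begin
    ⨁ (m + suc n) f                               ≡⟨ cong (λ k → ⨁ k f) (ℕ.+-suc m n) ⟩
    ⨁ (m + n) f ∙ f (m + n)                       ≡⟨ cong (_∙ f (m + n)) (⨁-+ m n f) ⟩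
    (⨁ m f ∙ ⨁ n (λ i → f (m + i))) ∙ f (m + n)   ≡⟨ assoc _ _ _ ⟩
    ⨁ m f ∙ ⨁ (suc n) (λ i → f (m + i))           ∎

  ⨁-swap : ∀ m n (f : ℕ → ℕ → A) → ⨁ m (λ i → ⨁ n (f i)) ≡ ⨁ n (λ j → ⨁ m (λ i → f i j))
  ⨁-swap zero    n f = sym (⨁-ε n)
  ⨁-swap (suc m) n f = begin
    ⨁ m (λ i → ⨁ n (f i)) ∙ ⨁ n (f m)                   ≡⟨ cong (_∙ ⨁ n (f m)) (⨁-swap m n f) ⟩
    ⨁ n (λ j → ⨁ m (λ i → f i j)) ∙ ⨁ n (f m)           ≡⟨ ⨁-distrib n (λ j → ⨁ m (λ i → f i j)) (f m) ⟨
    ⨁ n (λ j → ⨁ (suc m) (λ i → f i j))                  ∎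

  ⨁-reverse : ∀ n (f : ℕ → A) → ⨁ n (λ i → f (n ∸ suc i)) ≡ ⨁ n f
  ⨁-reverse zero    f = refl
  ⨁-reverse (suc n) f = begin
    ⨁ (suc n) (λ i → f (n ∸ i))        ≡⟨ ⨁-head n (λ i → f (n ∸ i)) ⟩
    f n ∙ ⨁ n (λ i → f (n ∸ suc i))    ≡⟨ cong (f n ∙_) (⨁-reverse n f) ⟩
    f n ∙ ⨁ n f                         ≡⟨ comm _ _ ⟩
    ⨁ (suc n) f                         ∎

  ⨁-extend : ∀ m n (f : ℕ → A) → (∀ i → m ≤ i → f i ≡ ε) → ⨁ (m + n) f ≡ ⨁ m f
  ⨁-extend m n f vanish = begin
    ⨁ (m + n) f                     ≡⟨ ⨁-+ m n f ⟩
    ⨁ m f ∙ ⨁ n (λ i → f (m + i))   ≡⟨ cong (⨁ m f ∙_) (trans (⨁-cong n (λ i _ → vanish (m + i) (ℕ.m≤m+n m i))) (⨁-ε n)) ⟩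
    ⨁ m f ∙ ε                       ≡⟨ identityʳ _ ⟩
    ⨁ m f                           ∎

  private
    reflected-index : ∀ {h} i → i < h → h + (h ∸ suc i) ≡ h + h ∸ suc i
    reflected-index {h} i i<h = sym (ℕ.+-∸-assoc h i<h)

  ⨁-pairs-even : ∀ h (f : ℕ → A) → ⨁ (h + h) f ≡ ⨁ h (λ i → f i ∙ f (h + h ∸ suc i))
  ⨁-pairs-even h f = begin
    ⨁ (h + h) f                                       ≡⟨ ⨁-+ h h f ⟩
    ⨁ h f ∙ ⨁ h (λ i → f (h + i))                     ≡⟨ cong (⨁ h f ∙_) (⨁-reverse h (λ i → f (h + i))) ⟨
    ⨁ h f ∙ ⨁ h (λ i → f (h + (h ∸ suc i)))           ≡⟨ cong (⨁ h f ∙_) (⨁-cong h (λ i i<h → cong f (reflected-index i i<h))) ⟩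
    ⨁ h f ∙ ⨁ h (λ i → f (h + h ∸ suc i))             ≡⟨ ⨁-distrib h f (λ i → f (h + h ∸ suc i)) ⟨
    ⨁ h (λ i → f i ∙ f (h + h ∸ suc i))               ∎

  ⨁-pairs-odd : ∀ h (f : ℕ → A) → ⨁ (suc (h + h)) f ≡ f h ∙ ⨁ h (λ i → f i ∙ f (h + h ∸ i))
  ⨁-pairs-odd h f = begin
    ⨁ (suc (h + h)) f                                            ≡⟨ cong (λ k → ⨁ k f) (ℕ.+-suc h h) ⟨
    ⨁ (h + suc h) f                                              ≡⟨ ⨁-+ h (suc h) f ⟩
    ⨁ h f ∙ ⨁ (suc h) (λ i → f (h + i))                          ≡⟨ cong (⨁ h f ∙_) (⨁-head h (λ i → f (h + i))) ⟩
    ⨁ h f ∙ (f (h + 0) ∙ ⨁ h (λ i → f (h + suc i)))              ≡⟨ cong (λ x → ⨁ h f ∙ (f x ∙ ⨁ h (λ i → f (h + suc i)))) (ℕ.+-identityʳ h) ⟩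
    ⨁ h f ∙ (f h ∙ ⨁ h (λ i → f (h + suc i)))                    ≡⟨ cong (λ x → ⨁ h f ∙ (f h ∙ x)) (⨁-reverse h (λ i → f (h + suc i))) ⟨
    ⨁ h f ∙ (f h ∙ ⨁ h (λ i → f (h + suc (h ∸ suc i))))          ≡⟨ cong (λ x → ⨁ h f ∙ (f h ∙ x)) (⨁-cong h (λ i i<h → cong f (index i i<h))) ⟩
    ⨁ h f ∙ (f h ∙ ⨁ h (λ i → f (h + h ∸ i)))                    ≡⟨ rearrange (⨁ h f) (f h) _ ⟩
    f h ∙ (⨁ h f ∙ ⨁ h (λ i → f (h + h ∸ i)))                    ≡⟨ cong (f h ∙_) (⨁-distrib h f (λ i → f (h + h ∸ i))) ⟨
    f h ∙ ⨁ h (λ i → f i ∙ f (h + h ∸ i))                        ∎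
    where
    index : ∀ i → i < h → h + suc (h ∸ suc i) ≡ h + h ∸ i
    index i i<h = trans (cong (λ x → h + x) (sym (ℕ.+-∸-assoc 1 i<h))) (sym (ℕ.+-∸-assoc h (ℕ.<⇒≤ i<h)))
    rearrange : ∀ a b c → a ∙ (b ∙ c) ≡ b ∙ (a ∙ c)
    rearrange a b c = trans (sym (assoc a b c)) (trans (cong (_∙ c) (comm a b)) (assoc b a c))

module Binomial where

  open import Data.Nat using (_+_; _*_; _∸_)
  open import Data.Nat.DivMod using (_/_; m/n*n≡m)
  open import Data.Nat.Properties using (_!≢0; _!*_!≢0)
  open import Data.Nat.Tactic.RingSolver using (solve-∀)
  open ≡-Reasoning

  C-factorials : ∀ a b → ((a + b) C a) * (a ! * b !) ≡ (a + b) !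
  C-factorials a b = begin
    ((a + b) C a) * (a ! * b !)           ≡⟨ cong (λ x → ((a + b) C a) * (a ! * x !)) (ℕ.m+n∸m≡n a b) ⟨
    ((a + b) C a) * (a ! * (a + b ∸ a) !) ≡⟨ cong (_* (a ! * (a + b ∸ a) !)) (nCk≡n!/k![n-k]! a≤a+b) ⟩
    (a + b) ! / (a ! * (a + b ∸ a) !) * (a ! * (a + b ∸ a) !) ≡⟨ m/n*n≡m (k![n∸k]!∣n! a≤a+b) ⟩
    (a + b) !                             ∎
    where
    a≤a+b : a ≤ a + b
    a≤a+b = ℕ.m≤m+n a b
    instance
      denominator≢0 : ℕ.NonZero (a ! * (a + b ∸ a) !)
      denominator≢0 = a !* (a + b ∸ a) !≢0

  private
    cancel-factorials : ∀ a b {x y} → x * (a ! * b !) ≡ y * (a ! * b !) → x ≡ y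
    cancel-factorials a b = ℕ.*-cancelʳ-≡ _ _ (a ! * b !) {{a !* b !≢0}}

  C-symmetric : ∀ a b → (a + b) C a ≡ (a + b) C b
  C-symmetric a b = trans (nCk≡nC[n∸k] (ℕ.m≤m+n a b)) (cong ((a + b) C_) (ℕ.m+n∸m≡n a b))

  private
    C-absorb-+ : ∀ k e → suc k * (suc (k + e) C suc k) ≡ suc (k + e) * ((k + e) C k)
    C-absorb-+ k e = cancel-factorials k e (begin
      suc k * X * (k ! * e !)             ≡⟨ shuffle (suc k) X (k !) (e !) ⟩
      X * ((suc k * k !) * e !)           ≡⟨ C-factorials (suc k) e ⟩
      suc (k + e) * (k + e) !             ≡⟨ cong (suc (k + e) *_) (C-factorials k e) ⟨
      suc (k + e) * (Y * (k ! * e !))     ≡⟨ ℕ.*-assoc (suc (k + e)) Y _ ⟨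
      suc (k + e) * Y * (k ! * e !)       ∎)
      where
      X : ℕ
      X = suc (k + e) C suc k
      Y : ℕ
      Y = (k + e) C k
      shuffle : ∀ s x u v → s * x * (u * v) ≡ x * ((s * u) * v)
      shuffle = solve-∀

  C-absorb : ∀ n k → suc k * (suc n C suc k) ≡ suc n * (n C k)
  C-absorb n k with ℕ.≤-<-connex k n
  ... | inj₁ k≤n = subst (λ n → suc k * (suc n C suc k) ≡ suc n * (n C k)) (ℕ.m+[n∸m]≡n k≤n) (C-absorb-+ k (n ∸ k))
  ... | inj₂ n<k = begin
    suc k * (suc n C suc k) ≡⟨ cong (suc k *_) (k>n⇒nCk≡0 (s≤s n<k)) ⟩
    suc k * 0               ≡⟨ ℕ.*-zeroʳ (suc k) ⟩
    0                       ≡⟨ ℕ.*-zeroʳ (suc n) ⟨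
    suc n * 0               ≡⟨ cong (suc n *_) (k>n⇒nCk≡0 n<k) ⟨
    suc n * (n C k)         ∎

  C-shift : ∀ a b → suc a * ((suc a + b) C suc a) ≡ suc b * ((a + suc b) C a)
  C-shift a b = cancel-factorials a b (begin
    suc a * X * (a ! * b !)           ≡⟨ shuffle₁ (suc a) X (a !) (b !) ⟩
    X * ((suc a * a !) * b !)         ≡⟨ C-factorials (suc a) b ⟩
    (suc a + b) !                     ≡⟨ cong _! (ℕ.+-suc a b) ⟨
    (a + suc b) !                     ≡⟨ C-factorials a (suc b) ⟨
    Y * (a ! * (suc b * b !))         ≡⟨ shuffle₂ (suc b) Y (a !) (b !) ⟩
    suc b * Y * (a ! * b !)           ∎)
    where
    X : ℕ
    X = (suc a + b) C suc a
    Y : ℕ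
    Y = (a + suc b) C a
    shuffle₁ : ∀ s x u v → s * x * (u * v) ≡ x * ((s * u) * v)
    shuffle₁ = solve-∀
    shuffle₂ : ∀ s x u v → x * (u * (s * v)) ≡ s * x * (u * v)
    shuffle₂ = solve-∀

  C-revision : ∀ a b c → ((a + b + c) C (a + b)) * ((a + b) C a) ≡ ((a + b + c) C a) * ((b + c) C b)
  C-revision a b c = ℕ.*-cancelʳ-≡ _ _ D {{D≢0}} (trans expand-lhs (sym expand-rhs))
    where
    D : ℕ
    D = a ! * b ! * c ! * ((a + b) ! * (b + c) !)
    D≢0 : ℕ.NonZero D
    D≢0 = ℕ.m*n≢0 (a ! * b ! * c !) _ {{ℕ.m*n≢0 _ _ {{a !* b !≢0}} {{c !≢0}}}} {{(a + b) !* (b + c) !≢0}}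
    X : ℕ
    X = (a + b + c) C (a + b)
    Y : ℕ
    Y = (a + b) C a
    Z : ℕ
    Z = (a + b + c) C a
    W : ℕ
    W = (b + c) C b
    expand-lhs : X * Y * D ≡ (a + b + c) ! * (a + b) ! * (b + c) !
    expand-lhs = begin
      X * Y * D                                          ≡⟨ shuffle X Y (a !) (b !) (c !) ((a + b) !) ((b + c) !) ⟩
      X * ((a + b) ! * c !) * (Y * (a ! * b !)) * (b + c) !  ≡⟨ cong₂ (λ x y → x * y * (b + c) !) (C-factorials (a + b) c) (C-factorials a b) ⟩
      (a + b + c) ! * (a + b) ! * (b + c) !              ∎
      where shuffle : ∀ x y u v w s t → x * y * (u * v * w * (s * t)) ≡ x * (s * w) * (y * (u * v)) * t
            shuffle = solve-∀
    expand-rhs : Z * W * D ≡ (a + b + c) ! * (a + b) ! * (b + c) !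
    expand-rhs = begin
      Z * W * D                                          ≡⟨ shuffle₁ Z W (a !) (b !) (c !) ((a + b) !) ((b + c) !) ⟩
      Z * (a ! * (b + c) !) * (W * (b ! * c !)) * (a + b) !  ≡⟨ cong₂ (λ x y → x * y * (a + b) !) Z-factorials (C-factorials b c) ⟩
      (a + b + c) ! * (b + c) ! * (a + b) !              ≡⟨ shuffle₂ ((a + b + c) !) ((b + c) !) ((a + b) !) ⟩
      (a + b + c) ! * (a + b) ! * (b + c) !              ∎
      where
      shuffle₁ : ∀ z w u v t r s → z * w * (u * v * t * (r * s)) ≡ z * (u * s) * (w * (v * t)) * r
      shuffle₁ = solve-∀
      shuffle₂ : ∀ x y z → x * y * z ≡ x * z * y
      shuffle₂ = solve-∀
      Z-factorials : Z * (a ! * (b + c) !) ≡ (a + b + c) !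
      Z-factorials = subst (λ n → (n C a) * (a ! * (b + c) !) ≡ n !) (sym (ℕ.+-assoc a b c)) (C-factorials a (b + c))

open Binomial

module SumsAndProducts where

  open import Data.Integer using (_+_; _*_; -_; _-_; _^_)
  open import Data.Integer.Tactic.RingSolver using (solve-∀)
  open ≡-Reasoning

  module Sum = RangeFold ℤ.+-0-isCommutativeMonoid
  module Product = RangeFold ℤ.*-1-isCommutativeMonoid
  open Sum public using () renaming (⨁ to ∑)
  open Product public using () renaming (⨁ to ∏)

  pos-^ : ∀ m n → + (m ℕ.^ n) ≡ (+ m) ^ n
  pos-^ m zero    = refl
  pos-^ m (suc n) = trans (ℤ.pos-* m (m ℕ.^ n)) (cong ((+ m) *_) (pos-^ m n))

  pos-*-≡ : ∀ a b c d → a ℕ.* b ≡ c ℕ.* d → + a * + b ≡ + c * + d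
  pos-*-≡ a b c d e = trans (sym (ℤ.pos-* a b)) (trans (cong +_ e) (ℤ.pos-* c d))

  pascal : ∀ n k → + (suc n C suc k) ≡ + (n C k) + + (n C suc k)
  pascal n k = trans (cong +_ (sym (nCk+nC[k+1]≡[n+1]C[k+1] n k))) (ℤ.pos-+ (n C k) (n C suc k))

  -1^-suc : ∀ k → -1ℤ ^ suc k ≡ - (-1ℤ ^ k)
  -1^-suc k = ℤ.-1*i≡-i (-1ℤ ^ k)

  -1^-square : ∀ k → -1ℤ ^ k * -1ℤ ^ k ≡ 1ℤ
  -1^-square zero    = refl
  -1^-square (suc k) = trans (cong₂ _*_ (-1^-suc k) (-1^-suc k)) (trans (negate-both (-1ℤ ^ k)) (-1^-square k))
    where negate-both : ∀ x → (- x) * (- x) ≡ x * x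
          negate-both = solve-∀

  -1^-even : ∀ h → -1ℤ ^ (h ℕ.+ h) ≡ 1ℤ
  -1^-even h = trans (ℤ.^-distribˡ-+-* -1ℤ h h) (-1^-square h)

  -1^-cases : ∀ k → -1ℤ ^ k ≡ 1ℤ ⊎ -1ℤ ^ k ≡ -1ℤ
  -1^-cases zero    = inj₁ refl
  -1^-cases (suc k) with -1^-cases k
  ... | inj₁ e = inj₂ (trans (-1^-suc k) (cong -_ e))
  ... | inj₂ e = inj₁ (trans (-1^-suc k) (cong -_ e))

  ^-double : ∀ x k → x ^ (k ℕ.+ k) ≡ (x * x) ^ k
  ^-double x k = trans (ℤ.^-distribˡ-+-* x k k) (sym (^-distrib-* x x k))
    where
    ^-distrib-* : ∀ x y k → (x * y) ^ k ≡ x ^ k * y ^ k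
    ^-distrib-* x y zero    = refl
    ^-distrib-* x y (suc k) = trans (cong (x * y *_) (^-distrib-* x y k)) (shuffle x y (x ^ k) (y ^ k))
      where shuffle : ∀ x y a b → x * y * (a * b) ≡ x * a * (y * b)
            shuffle = solve-∀

  sumTo-∑ : ∀ n f → + sumTo n f ≡ ∑ (suc n) (λ k → + f k)
  sumTo-∑ zero    f = refl
  sumTo-∑ (suc n) f = trans (ℤ.pos-+ (sumTo n f) (f (suc n))) (cong (_+ + f (suc n)) (sumTo-∑ n f))

  sumFrom1-∑ : ∀ n f → + sumFrom1 n f ≡ ∑ n (λ k → + f (suc k))
  sumFrom1-∑ zero    f = refl
  sumFrom1-∑ (suc n) f = trans (ℤ.pos-+ (sumFrom1 n f) (f (suc n))) (cong (_+ + f (suc n)) (sumFrom1-∑ n f))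

  ∑-*ˡ : ∀ n c f → ∑ n (λ i → c * f i) ≡ c * ∑ n f
  ∑-*ˡ zero    c f = sym (ℤ.*-zeroʳ c)
  ∑-*ˡ (suc n) c f = trans (cong (_+ c * f n) (∑-*ˡ n c f)) (sym (ℤ.*-distribˡ-+ c (∑ n f) (f n)))

  ∑-neg : ∀ n f → ∑ n (λ i → - f i) ≡ - ∑ n f
  ∑-neg zero    f = refl
  ∑-neg (suc n) f = trans (cong (_+ - f n) (∑-neg n f)) (sym (ℤ.neg-distrib-+ (∑ n f) (f n)))

  ∏-neg : ∀ n f → ∏ n (λ i → - f i) ≡ -1ℤ ^ n * ∏ n f
  ∏-neg zero    f = sym (ℤ.*-identityˡ 1ℤ)
  ∏-neg (suc n) f = trans (cong (_* - f n) (∏-neg n f)) (shuffle (-1ℤ ^ n) (∏ n f) (f n))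
    where shuffle : ∀ s x y → s * x * (- y) ≡ -1ℤ * s * (x * y)
          shuffle = solve-∀

  module _ {m : ℤ} where

    ∑-cong-mod : ∀ n {f g} → (∀ i → i < n → f i ≡ g i mod m) → ∑ n f ≡ ∑ n g mod m
    ∑-cong-mod zero    f≡g = mod-refl
    ∑-cong-mod (suc n) f≡g = +-cong (∑-cong-mod n (λ i i<n → f≡g i (ℕ.m<n⇒m<1+n i<n))) (f≡g n ℕ.≤-refl)

    ∏-cong-mod : ∀ n {f g} → (∀ i → i < n → f i ≡ g i mod m) → ∏ n f ≡ ∏ n g mod m
    ∏-cong-mod zero    f≡g = mod-refl
    ∏-cong-mod (suc n) f≡g = *-cong (∏-cong-mod n (λ i i<n → f≡g i (ℕ.m<n⇒m<1+n i<n))) (f≡g n ℕ.≤-refl)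

  factorial-∏ : ∀ n → + (n !) ≡ ∏ n (λ i → + suc i)
  factorial-∏ zero    = refl
  factorial-∏ (suc n) = trans (ℤ.pos-* (suc n) (n !)) (trans (ℤ.*-comm (+ suc n) (+ (n !))) (cong (_* + suc n) (factorial-∏ n)))

  rising-factorial : ∀ m k → + (k !) * + ((m ℕ.+ k) C k) ≡ ∏ k (λ j → + (m ℕ.+ suc j))
  rising-factorial m zero    = refl
  rising-factorial m (suc k) = begin
    + (suc k ℕ.* k !) * + ((m ℕ.+ suc k) C suc k)      ≡⟨ cong₂ _*_ (ℤ.pos-* (suc k) (k !)) (cong (λ n → + (n C suc k)) (ℕ.+-suc m k)) ⟩
    + suc k * + (k !) * + (suc (m ℕ.+ k) C suc k)      ≡⟨ shuffle (+ suc k) (+ (k !)) _ ⟩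
    + (k !) * (+ suc k * + (suc (m ℕ.+ k) C suc k))    ≡⟨ cong (+ (k !) *_) (pos-*-≡ (suc k) _ (suc (m ℕ.+ k)) ((m ℕ.+ k) C k) (C-absorb (m ℕ.+ k) k)) ⟩
    + (k !) * (+ suc (m ℕ.+ k) * + ((m ℕ.+ k) C k))    ≡⟨ shuffle′ (+ (k !)) (+ suc (m ℕ.+ k)) _ ⟩
    + (k !) * + ((m ℕ.+ k) C k) * + suc (m ℕ.+ k)      ≡⟨ cong₂ _*_ (rising-factorial m k) (cong +_ (sym (ℕ.+-suc m k))) ⟩
    ∏ (suc k) (λ j → + (m ℕ.+ suc j))                  ∎
    where
    shuffle : ∀ a b c → a * b * c ≡ b * (a * c)
    shuffle = solve-∀
    shuffle′ : ∀ a b c → a * (b * c) ≡ a * c * b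
    shuffle′ = solve-∀

open SumsAndProducts

module AlternatingSums where

  open import Data.Integer using (_+_; _*_; -_; _-_; _^_)
  open import Data.Integer.Tactic.RingSolver using (solve-∀)
  open ≡-Reasoning

  private
    C-after-top : ∀ n → + (n C suc n) ≡ 0ℤ
    C-after-top n = cong +_ (k>n⇒nCk≡0 (ℕ.n<1+n n))

  binomial-theorem : ∀ n x → (1ℤ + x) ^ n ≡ ∑ (suc n) (λ k → + (n C k) * x ^ k)
  binomial-theorem zero    x = refl
  binomial-theorem (suc n) x = sym (begin
    ∑ (suc (suc n)) (λ k → + (suc n C k) * x ^ k)                  ≡⟨ Sum.⨁-head (suc n) _ ⟩
    1ℤ + ∑ (suc n) (λ i → + (suc n C suc i) * x ^ suc i)           ≡⟨ cong (λ y → 1ℤ + y) (Sum.⨁-cong (suc n) (λ i _ → split i)) ⟩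
    1ℤ + ∑ (suc n) (λ i → x * F i + F (suc i))                     ≡⟨ cong (λ y → 1ℤ + y) (Sum.⨁-distrib (suc n) (λ i → x * F i) (λ i → F (suc i))) ⟩
    1ℤ + (∑ (suc n) (λ i → x * F i) + ∑ (suc n) (λ i → F (suc i))) ≡⟨ cong (λ y → 1ℤ + (y + ∑ (suc n) (λ i → F (suc i)))) (∑-*ˡ (suc n) x F) ⟩
    1ℤ + (x * ∑ (suc n) F + ∑ (suc n) (λ i → F (suc i)))           ≡⟨ shuffle 1ℤ (x * ∑ (suc n) F) _ ⟩
    x * ∑ (suc n) F + (1ℤ + ∑ (suc n) (λ i → F (suc i)))           ≡⟨ cong (λ y → x * ∑ (suc n) F + y) (Sum.⨁-head (suc n) F) ⟨
    x * ∑ (suc n) F + (∑ (suc n) F + F (suc n))                    ≡⟨ cong (λ c → x * ∑ (suc n) F + (∑ (suc n) F + c * x ^ suc n)) (C-after-top n) ⟩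
    x * ∑ (suc n) F + (∑ (suc n) F + 0ℤ * x ^ suc n)               ≡⟨ factor x (∑ (suc n) F) (x ^ suc n) ⟩
    (1ℤ + x) * ∑ (suc n) F                                         ≡⟨ cong ((1ℤ + x) *_) (binomial-theorem n x) ⟨
    (1ℤ + x) ^ suc n                                               ∎)
    where
    F : ℕ → ℤ
    F k = + (n C k) * x ^ k
    split : ∀ i → + (suc n C suc i) * x ^ suc i ≡ x * F i + F (suc i)
    split i = trans (cong (_* x ^ suc i) (pascal n i)) (distribute (+ (n C i)) (+ (n C suc i)) x (x ^ i))
      where distribute : ∀ a b x y → (a + b) * (x * y) ≡ x * (a * y) + b * (x * y)
            distribute = solve-∀
    shuffle : ∀ a b c → a + (b + c) ≡ b + (a + c)
    shuffle = solve-∀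
    factor : ∀ x s y → x * s + (s + 0ℤ * y) ≡ (1ℤ + x) * s
    factor = solve-∀

  alternating-row : ∀ n → ∑ (suc (suc n)) (λ k → -1ℤ ^ k * + (suc n C k)) ≡ 0ℤ
  alternating-row n = begin
    ∑ (suc (suc n)) (λ k → -1ℤ ^ k * + (suc n C k))  ≡⟨ Sum.⨁-head (suc n) _ ⟩
    1ℤ + ∑ (suc n) (λ i → -1ℤ ^ suc i * + (suc n C suc i)) ≡⟨ cong (λ y → 1ℤ + y) (Sum.⨁-cong (suc n) (λ i _ → split i)) ⟩
    1ℤ + ∑ (suc n) (λ i → - V i + - W i)              ≡⟨ cong (λ y → 1ℤ + y) (Sum.⨁-distrib (suc n) (λ i → - V i) (λ i → - W i)) ⟩
    1ℤ + (∑ (suc n) (λ i → - V i) + ∑ (suc n) (λ i → - W i)) ≡⟨ cong₂ (λ y z → 1ℤ + (y + z)) (∑-neg (suc n) V) (∑-neg (suc n) W) ⟩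
    1ℤ + (- ∑ (suc n) V + - ∑ (suc n) W)              ≡⟨ cong (λ y → 1ℤ + (- y + - ∑ (suc n) W)) ∑V≡1-∑W ⟩
    1ℤ + (- (1ℤ + - ∑ (suc n) W) + - ∑ (suc n) W)    ≡⟨ cancel (∑ (suc n) W) ⟩
    0ℤ                                               ∎
    where
    V W : ℕ → ℤ
    V i = -1ℤ ^ i * + (n C i)
    W i = -1ℤ ^ i * + (n C suc i)
    split : ∀ i → -1ℤ ^ suc i * + (suc n C suc i) ≡ - V i + - W i
    split i = trans (cong (-1ℤ ^ suc i *_) (pascal n i)) (distribute (-1ℤ ^ i) (+ (n C i)) (+ (n C suc i)))
      where distribute : ∀ s a b → -1ℤ * s * (a + b) ≡ - (s * a) + - (s * b)
            distribute = solve-∀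
    ∑V≡1-∑W : ∑ (suc n) V ≡ 1ℤ + - ∑ (suc n) W
    ∑V≡1-∑W = begin
      ∑ (suc n) V                                    ≡⟨ ℤ.+-identityʳ _ ⟨
      ∑ (suc n) V + 0ℤ                               ≡⟨ cong (λ c → ∑ (suc n) V + c) (ℤ.*-zeroʳ (-1ℤ ^ suc n)) ⟨
      ∑ (suc n) V + -1ℤ ^ suc n * 0ℤ                 ≡⟨ cong (λ c → ∑ (suc n) V + -1ℤ ^ suc n * c) (C-after-top n) ⟨
      ∑ (suc (suc n)) V                              ≡⟨ Sum.⨁-head (suc n) V ⟩
      1ℤ + ∑ (suc n) (λ i → V (suc i))               ≡⟨ cong (λ y → 1ℤ + y) (Sum.⨁-cong (suc n) (λ i _ → negate i)) ⟩
      1ℤ + ∑ (suc n) (λ i → - W i)                   ≡⟨ cong (λ y → 1ℤ + y) (∑-neg (suc n) W) ⟩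
      1ℤ + - ∑ (suc n) W                             ∎
      where negate : ∀ i → V (suc i) ≡ - W i
            negate i = sym (trans (ℤ.neg-distribˡ-* (-1ℤ ^ i) _) (cong (_* + (n C suc i)) (sym (-1^-suc i))))
    cancel : ∀ w → 1ℤ + (- (1ℤ + - w) + - w) ≡ 0ℤ
    cancel = solve-∀

  alternating : ℕ → ℕ → ℤ → ℤ
  alternating n j a = ∑ (suc n) (λ k → -1ℤ ^ k * (+ (n C k) * (+ k + a) ^ j))

  alternating-step : ∀ n j a → alternating (suc n) (suc j) a ≡ - + suc n * alternating n j (a + 1ℤ) + a * alternating (suc n) j a
  alternating-step n j a = begin
    alternating (suc n) (suc j) a                                   ≡⟨ Sum.⨁-cong (suc (suc n)) (λ k _ → split k) ⟩
    ∑ (suc (suc n)) (λ k → + k * U k + a * U k)                     ≡⟨ Sum.⨁-distrib (suc (suc n)) (λ k → + k * U k) (λ k → a * U k) ⟩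
    ∑ (suc (suc n)) (λ k → + k * U k) + ∑ (suc (suc n)) (λ k → a * U k) ≡⟨ cong₂ _+_ weighted (∑-*ˡ (suc (suc n)) a U) ⟩
    - + suc n * alternating n j (a + 1ℤ) + a * alternating (suc n) j a ∎
    where
    U : ℕ → ℤ
    U k = -1ℤ ^ k * (+ (suc n C k) * (+ k + a) ^ j)
    split : ∀ k → -1ℤ ^ k * (+ (suc n C k) * (+ k + a) ^ suc j) ≡ + k * U k + a * U k
    split k = distribute (-1ℤ ^ k) (+ (suc n C k)) (+ k) a ((+ k + a) ^ j)
      where distribute : ∀ s c k a w → s * (c * ((k + a) * w)) ≡ k * (s * (c * w)) + a * (s * (c * w))
            distribute = solve-∀
    absorbed : ∀ i → + suc i * U (suc i) ≡ - + suc n * (-1ℤ ^ i * (+ (n C i) * (+ i + (a + 1ℤ)) ^ j))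
    absorbed i = begin
      + suc i * (-1ℤ ^ suc i * (+ (suc n C suc i) * (+ suc i + a) ^ j))   ≡⟨ shuffle (+ suc i) (-1ℤ ^ i) (+ (suc n C suc i)) ((+ suc i + a) ^ j) ⟩
      - (+ suc i * + (suc n C suc i) * -1ℤ ^ i * (+ suc i + a) ^ j)        ≡⟨ cong₂ (λ x y → - (x * -1ℤ ^ i * y ^ j)) (pos-*-≡ (suc i) _ (suc n) _ (C-absorb n i)) (shift-index i) ⟩
      - (+ suc n * + (n C i) * -1ℤ ^ i * (+ i + (a + 1ℤ)) ^ j)             ≡⟨ shuffle′ (+ suc n) (+ (n C i)) (-1ℤ ^ i) ((+ i + (a + 1ℤ)) ^ j) ⟩
      - + suc n * (-1ℤ ^ i * (+ (n C i) * (+ i + (a + 1ℤ)) ^ j))          ∎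
      where
      shuffle : ∀ c s b w → c * (-1ℤ * s * (b * w)) ≡ - (c * b * s * w)
      shuffle = solve-∀
      shuffle′ : ∀ m c s w → - (m * c * s * w) ≡ - m * (s * (c * w))
      shuffle′ = solve-∀
      shift-index : ∀ i → + suc i + a ≡ + i + (a + 1ℤ)
      shift-index i = trans (cong (_+ a) (ℤ.pos-+ 1 i)) (commute (+ i) a)
        where commute : ∀ x a → 1ℤ + x + a ≡ x + (a + 1ℤ)
              commute = solve-∀
    weighted : ∑ (suc (suc n)) (λ k → + k * U k) ≡ - + suc n * alternating n j (a + 1ℤ)
    weighted = begin
      ∑ (suc (suc n)) (λ k → + k * U k)                           ≡⟨ Sum.⨁-head (suc n) _ ⟩
      0ℤ * U 0 + ∑ (suc n) (λ i → + suc i * U (suc i))            ≡⟨ cong₂ _+_ (ℤ.*-zeroˡ (U 0)) (Sum.⨁-cong (suc n) (λ i _ → absorbed i)) ⟩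
      0ℤ + ∑ (suc n) (λ i → - + suc n * (-1ℤ ^ i * (+ (n C i) * (+ i + (a + 1ℤ)) ^ j))) ≡⟨ ℤ.+-identityˡ _ ⟩
      ∑ (suc n) (λ i → - + suc n * (-1ℤ ^ i * (+ (n C i) * (+ i + (a + 1ℤ)) ^ j)))      ≡⟨ ∑-*ˡ (suc n) (- + suc n) _ ⟩
      - + suc n * alternating n j (a + 1ℤ)                        ∎

  alternating-below : ∀ j n a → j < n → alternating n j a ≡ 0ℤ
  alternating-below zero (suc n) a _ =
    trans (Sum.⨁-cong (suc (suc n)) (λ k _ → cong (-1ℤ ^ k *_) (ℤ.*-identityʳ (+ (suc n C k))))) (alternating-row n)
  alternating-below (suc j) (suc n) a (s≤s j<n) = begin
    alternating (suc n) (suc j) a                                          ≡⟨ alternating-step n j a ⟩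
    - + suc n * alternating n j (a + 1ℤ) + a * alternating (suc n) j a     ≡⟨ cong₂ (λ x y → - + suc n * x + a * y) (alternating-below j n (a + 1ℤ) j<n) (alternating-below j (suc n) a (ℕ.m<n⇒m<1+n j<n)) ⟩
    - + suc n * 0ℤ + a * 0ℤ                                                ≡⟨ vanish (+ suc n) a ⟩
    0ℤ                                                                     ∎
    where vanish : ∀ m a → - m * 0ℤ + a * 0ℤ ≡ 0ℤ
          vanish = solve-∀

  alternating-top : ∀ n a → alternating n n a ≡ -1ℤ ^ n * + (n !)
  alternating-top zero    a = refl
  alternating-top (suc n) a = begin
    alternating (suc n) (suc n) a                                          ≡⟨ alternating-step n n a ⟩
    - + suc n * alternating n n (a + 1ℤ) + a * alternating (suc n) n a     ≡⟨ cong₂ (λ x y → - + suc n * x + a * y) (alternating-top n (a + 1ℤ)) (alternating-below n (suc n) a ℕ.≤-refl) ⟩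
    - + suc n * (-1ℤ ^ n * + (n !)) + a * 0ℤ                               ≡⟨ shuffle (+ suc n) (-1ℤ ^ n) (+ (n !)) a ⟩
    -1ℤ ^ suc n * (+ suc n * + (n !))                                      ≡⟨ cong (-1ℤ ^ suc n *_) (ℤ.pos-* (suc n) (n !)) ⟨
    -1ℤ ^ suc n * + (suc n !)                                              ∎
    where shuffle : ∀ m s f a → - m * (s * f) + a * 0ℤ ≡ -1ℤ * s * (m * f)
          shuffle = solve-∀

open AlternatingSums

module CatalanSums where

  open import Data.Nat using (_+_; _*_; _∸_)
  open import Data.Nat.DivMod using (_/_; m*n/n≡m)
  open import Data.Nat.Tactic.RingSolver using (solve-∀)
  open ≡-Reasoning

  catalan : ℕ → ℕ
  catalan k = (k + k) C k ∸ (k + k) C suc k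

  suc-*-catalan : ∀ k → suc k * catalan k ≡ (k + k) C k
  suc-*-catalan zero     = refl
  suc-*-catalan (suc j) = begin
    suc k * (X ∸ Y)            ≡⟨ ℕ.*-distribˡ-∸ (suc k) X Y ⟩
    suc k * X ∸ suc k * Y      ≡⟨ cong (suc k * X ∸_) k+1-*-Y ⟩
    (X + k * X) ∸ k * X        ≡⟨ ℕ.m+n∸n≡m X (k * X) ⟩
    X                          ∎
    where
    k : ℕ
    k = suc j
    X : ℕ
    X = (k + k) C k
    Y : ℕ
    Y = (k + k) C suc k
    k+1-*-Y : suc k * Y ≡ k * X
    k+1-*-Y = subst (λ n → suc k * (n C suc k) ≡ k * X) (cong suc (sym (ℕ.+-suc j j))) (C-shift k j)

  odd-central-C : ∀ k → (k + suc k) C k ≡ suc (k + k) * catalan k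
  odd-central-C k = ℕ.*-cancelˡ-≡ _ _ (suc k) (begin
    suc k * ((k + suc k) C k)           ≡⟨ cong (suc k *_) (C-symmetric k (suc k)) ⟩
    suc k * ((k + suc k) C suc k)       ≡⟨ cong (λ n → suc k * (n C suc k)) (ℕ.+-suc k k) ⟩
    suc k * (suc (k + k) C suc k)       ≡⟨ C-absorb (k + k) k ⟩
    suc (k + k) * ((k + k) C k)         ≡⟨ cong (suc (k + k) *_) (suc-*-catalan k) ⟨
    suc (k + k) * (suc k * catalan k)   ≡⟨ shuffle (suc (k + k)) (suc k) (catalan k) ⟩
    suc k * (suc (k + k) * catalan k)   ∎)
    where shuffle : ∀ a b c → a * (b * c) ≡ b * (a * c)
          shuffle = solve-∀

  C*C-catalan : ∀ n k → (n C k) * ((n + k) C k) ≡ catalan k * ((n + k) C (k + k)) * suc k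
  C*C-catalan n k with ℕ.≤-<-connex k n
  ... | inj₂ n<k = begin
    (n C k) * ((n + k) C k)              ≡⟨ cong (_* ((n + k) C k)) (k>n⇒nCk≡0 n<k) ⟩
    0                                    ≡⟨ cong (_* suc k) (ℕ.*-zeroʳ (catalan k)) ⟨
    catalan k * 0 * suc k                ≡⟨ cong (λ x → catalan k * x * suc k) (k>n⇒nCk≡0 (ℕ.+-monoˡ-< k n<k)) ⟨
    catalan k * ((n + k) C (k + k)) * suc k ∎
  ... | inj₁ k≤n = subst (λ n → (n C k) * ((n + k) C k) ≡ catalan k * ((n + k) C (k + k)) * suc k)
                         (ℕ.m+[n∸m]≡n k≤n) (split k (n ∸ k))
    where
    split : ∀ k d → ((k + d) C k) * ((k + d + k) C k) ≡ catalan k * ((k + d + k) C (k + k)) * suc k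
    split k d = begin
      ((k + d) C k) * ((k + d + k) C k)            ≡⟨ ℕ.*-comm ((k + d) C k) _ ⟩
      ((k + d + k) C k) * ((k + d) C k)            ≡⟨ cong (λ n → (n C k) * ((k + d) C k)) reorder ⟩
      ((k + k + d) C k) * ((k + d) C k)            ≡⟨ C-revision k k d ⟨
      ((k + k + d) C (k + k)) * ((k + k) C k)      ≡⟨ cong (λ n → (n C (k + k)) * ((k + k) C k)) reorder ⟨
      ((k + d + k) C (k + k)) * ((k + k) C k)      ≡⟨ cong (((k + d + k) C (k + k)) *_) (suc-*-catalan k) ⟨
      ((k + d + k) C (k + k)) * (suc k * catalan k) ≡⟨ shuffle ((k + d + k) C (k + k)) (suc k) (catalan k) ⟩
      catalan k * ((k + d + k) C (k + k)) * suc k  ∎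
      where
      reorder : k + d + k ≡ k + k + d
      reorder = rearrange k d
        where rearrange : ∀ k d → k + d + k ≡ k + k + d
              rearrange = solve-∀
      shuffle : ∀ x s c → x * (s * c) ≡ c * x * s
      shuffle = solve-∀

  S-summand : ∀ n k → ((n C k) * ((n + k) C k)) / suc k ≡ catalan k * ((n + k) C (k + k))
  S-summand n k = trans (cong (_/ suc k) (C*C-catalan n k)) (m*n/n≡m _ (suc k))

  S-∑ : ∀ n m → n < m → + S n ≡ ∑ m (λ k → + (catalan k * ((n + k) C (k + k))))
  S-∑ n m n<m = begin
    + S n                                               ≡⟨ sumTo-∑ n _ ⟩
    ∑ (suc n) (λ k → + (((n C k) * ((n + k) C k)) / suc k))  ≡⟨ Sum.⨁-cong (suc n) (λ k _ → cong +_ (S-summand n k)) ⟩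
    ∑ (suc n) g                                         ≡⟨ Sum.⨁-extend (suc n) (m ∸ suc n) g vanish ⟨
    ∑ (suc n + (m ∸ suc n)) g                           ≡⟨ cong (λ l → ∑ l g) (ℕ.m+[n∸m]≡n n<m) ⟩
    ∑ m g                                               ∎
    where
    g : ℕ → ℤ
    g k = + (catalan k * ((n + k) C (k + k)))
    vanish : ∀ k → suc n ≤ k → g k ≡ + 0
    vanish k n<k = cong +_ (trans (cong (catalan k *_) (k>n⇒nCk≡0 (ℕ.+-monoˡ-< k n<k))) (ℕ.*-zeroʳ (catalan k)))

  hockey-stick : ∀ m k j → k ≤ j → ∑ m (λ n → + ((n + k) C j)) ≡ + ((m + k) C suc j)
  hockey-stick zero    k j k≤j = sym (cong +_ (k>n⇒nCk≡0 (s≤s k≤j)))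
  hockey-stick (suc m) k j k≤j = begin
    ∑ m (λ n → + ((n + k) C j)) ℤ.+ + ((m + k) C j)     ≡⟨ cong (ℤ._+ + ((m + k) C j)) (hockey-stick m k j k≤j) ⟩
    + ((m + k) C suc j) ℤ.+ + ((m + k) C j)             ≡⟨ ℤ.+-comm (+ ((m + k) C suc j)) (+ ((m + k) C j)) ⟩
    + ((m + k) C j) ℤ.+ + ((m + k) C suc j)             ≡⟨ ℤ.pos-+ ((m + k) C j) _ ⟨
    + ((m + k) C j + (m + k) C suc j)                   ≡⟨ cong +_ (nCk+nC[k+1]≡[n+1]C[k+1] (m + k) j) ⟩
    + (suc (m + k) C suc j)                             ∎

  τ : ℕ → ℕ → ℕ
  τ m k = catalan k * ((m + k) C suc (k + k))

  ∑-S : ∀ m → ∑ m (λ n → + S n) ≡ ∑ m (λ k → + τ m k)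
  ∑-S m = begin
    ∑ m (λ n → + S n)                                                  ≡⟨ Sum.⨁-cong m (λ n n<m → S-∑ n m n<m) ⟩
    ∑ m (λ n → ∑ m (λ k → + (catalan k * ((n + k) C (k + k)))))        ≡⟨ Sum.⨁-swap m m _ ⟩
    ∑ m (λ k → ∑ m (λ n → + (catalan k * ((n + k) C (k + k)))))        ≡⟨ Sum.⨁-cong m (λ k _ → factor k) ⟩
    ∑ m (λ k → + catalan k ℤ.* + ((m + k) C suc (k + k)))              ≡⟨ Sum.⨁-cong m (λ k _ → ℤ.pos-* (catalan k) _) ⟨
    ∑ m (λ k → + τ m k)                                                ∎
    where
    factor : ∀ k → ∑ m (λ n → + (catalan k * ((n + k) C (k + k)))) ≡ + catalan k ℤ.* + ((m + k) C suc (k + k))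
    factor k = begin
      ∑ m (λ n → + (catalan k * ((n + k) C (k + k))))     ≡⟨ Sum.⨁-cong m (λ n _ → ℤ.pos-* (catalan k) _) ⟩
      ∑ m (λ n → + catalan k ℤ.* + ((n + k) C (k + k)))   ≡⟨ ∑-*ˡ m (+ catalan k) _ ⟩
      + catalan k ℤ.* ∑ m (λ n → + ((n + k) C (k + k)))   ≡⟨ cong (+ catalan k ℤ.*_) (hockey-stick m k (k + k) (ℕ.m≤m+n k k)) ⟩
      + catalan k ℤ.* + ((m + k) C suc (k + k))           ∎

  τ-odd-multiple : ∀ m k → suc (k + k) * τ m k ≡ ((m + k) C k) * (m C suc k)
  τ-odd-multiple m k with ℕ.≤-<-connex m k
  ... | inj₁ m≤k = begin
    suc (k + k) * (catalan k * ((m + k) C suc (k + k)))  ≡⟨ cong (λ x → suc (k + k) * (catalan k * x)) (k>n⇒nCk≡0 (s≤s (ℕ.+-monoˡ-≤ k m≤k))) ⟩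
    suc (k + k) * (catalan k * 0)                        ≡⟨ cong (suc (k + k) *_) (ℕ.*-zeroʳ (catalan k)) ⟩
    suc (k + k) * 0                                      ≡⟨ ℕ.*-zeroʳ (suc (k + k)) ⟩
    0                                                    ≡⟨ ℕ.*-zeroʳ ((m + k) C k) ⟨
    ((m + k) C k) * 0                                    ≡⟨ cong (((m + k) C k) *_) (k>n⇒nCk≡0 (s≤s m≤k)) ⟨
    ((m + k) C k) * (m C suc k)                          ∎
  ... | inj₂ k<m = subst (λ m → suc (k + k) * τ m k ≡ ((m + k) C k) * (m C suc k)) (ℕ.m+[n∸m]≡n k<m) (split k (m ∸ suc k))
    where
    split : ∀ k e → suc (k + k) * τ (suc k + e) k ≡ ((suc k + e + k) C k) * ((suc k + e) C suc k)
    split k e = begin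
      suc (k + k) * (catalan k * ((n + k) C suc (k + k)))  ≡⟨ ℕ.*-assoc (suc (k + k)) (catalan k) _ ⟨
      suc (k + k) * catalan k * ((n + k) C suc (k + k))    ≡⟨ cong₂ (λ x y → x * y) (odd-central-C k) (cong₂ _C_ (sym reorder) (ℕ.+-suc k k)) ⟨
      ((k + suc k) C k) * ((k + suc k + e) C (k + suc k))  ≡⟨ ℕ.*-comm ((k + suc k) C k) _ ⟩
      ((k + suc k + e) C (k + suc k)) * ((k + suc k) C k)  ≡⟨ C-revision k (suc k) e ⟩
      ((k + suc k + e) C k) * ((suc k + e) C suc k)        ≡⟨ cong (λ n → (n C k) * ((suc k + e) C suc k)) reorder ⟨
      ((n + k) C k) * (n C suc k)                          ∎
      where
      n : ℕ
      n = suc k + e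
      reorder : n + k ≡ k + suc k + e
      reorder = rearrange k e
        where rearrange : ∀ k e → suc k + e + k ≡ k + suc k + e
              rearrange = solve-∀

  τ-central : ∀ h → suc h * τ (suc (h + h)) h ≡ ((suc (h + h) + h) C h) * ((h + h) C h)
  τ-central h = ℕ.*-cancelˡ-≡ _ _ p (begin
    p * (suc h * τ p h)                          ≡⟨ swap p (suc h) (τ p h) ⟩
    suc h * (p * τ p h)                          ≡⟨ cong (suc h *_) (τ-odd-multiple p h) ⟩
    suc h * (((p + h) C h) * (p C suc h))        ≡⟨ swap (suc h) ((p + h) C h) (p C suc h) ⟩
    ((p + h) C h) * (suc h * (p C suc h))        ≡⟨ cong (((p + h) C h) *_) (C-absorb (h + h) h) ⟩
    ((p + h) C h) * (p * ((h + h) C h))          ≡⟨ swap ((p + h) C h) p ((h + h) C h) ⟩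
    p * (((p + h) C h) * ((h + h) C h))          ∎)
    where
    p : ℕ
    p = suc (h + h)
    swap : ∀ a b c → a * (b * c) ≡ b * (a * c)
    swap = solve-∀

open CatalanSums

module ModPrime (n : ℕ) (prime : Prime (suc n)) where

  open import Data.Integer using (_+_; _*_; -_; _-_; _^_)
  open import Data.Integer.Tactic.RingSolver using (solve-∀)

  p : ℕ
  p = suc n

  P : ℤ
  P = + p

  1≤n : 1 ≤ n
  1≤n = ℕ.≤-pred (ℕ.nonTrivial⇒n>1 p {{prime⇒nonTrivial prime}})

  0<c<p⇒p∤c : ∀ {c} → 0 < c → c < p → ¬ p ℕ.∣ c
  0<c<p⇒p∤c {suc _} _ c<p p∣c = ℕ.<⇒≱ c<p (ℕ.∣⇒≤ p∣c)

  k<p⇒p∤k! : ∀ k → k < p → ¬ p ℕ.∣ k !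
  k<p⇒p∤k! zero    _    = 0<c<p⇒p∤c (s≤s z≤n) (s≤s 1≤n)
  k<p⇒p∤k! (suc k) k<p p∣k! with euclidsLemma (suc k) (k !) prime p∣k!
  ... | inj₁ p∣k = 0<c<p⇒p∤c (s≤s z≤n) k<p p∣k
  ... | inj₂ p∣k! = k<p⇒p∤k! k (ℕ.<-trans (ℕ.n<1+n k) k<p) p∣k!

  *-cancelˡ-mod-p : ∀ {c a b} → 0 < c → c < p → + c * a ≡ + c * b mod P → a ≡ b mod P
  *-cancelˡ-mod-p {c} 0<c c<p = *-cancelˡ-mod-prime prime {+ c} (0<c<p⇒p∤c 0<c c<p)

  *-cancelˡ-mod-p² : ∀ {c a b} → 0 < c → c < p → + c * a ≡ + c * b mod (P * P) → a ≡ b mod (P * P)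
  *-cancelˡ-mod-p² {c} 0<c c<p = *-cancelˡ-mod-prime² prime {+ c} (0<c<p⇒p∤c 0<c c<p)

  !-*-cancelˡ-mod-p² : ∀ k {a b} → k < p → + (k !) * a ≡ + (k !) * b mod (P * P) → a ≡ b mod (P * P)
  !-*-cancelˡ-mod-p² k k<p = *-cancelˡ-mod-prime² prime {+ (k !)} (k<p⇒p∤k! k k<p)

  P*x≡0 : ∀ x → P * x ≡ 0ℤ mod P
  P*x≡0 x = subst (λ y → y ≡ 0ℤ mod P) (ℤ.*-comm x P) (multiple≡0 x)

  C-prime≡0 : ∀ k → k < n → + (p C suc k) ≡ 0ℤ mod P
  C-prime≡0 k k<n = *-cancelˡ-mod-p (s≤s z≤n) (s≤s k<n) (begin
    + suc k * + (p C suc k)   ≡⟨ pos-*-≡ (suc k) _ p (n C k) (C-absorb n k) ⟩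
    P * + (n C k)             ≈⟨ P*x≡0 _ ⟩
    0ℤ                        ≡⟨ ℤ.*-zeroʳ (+ suc k) ⟨
    + suc k * 0ℤ              ∎)
    where open ≡-mod-Reasoning P

  C-below-prime : ∀ k → k ≤ n → + (n C k) ≡ -1ℤ ^ k mod P
  C-below-prime zero    _     = mod-refl
  C-below-prime (suc k) k<n = begin
    + (n C suc k)                                ≡⟨ difference ⟩
    + (p C suc k) - + (n C k)                    ≈⟨ sub-cong (C-prime≡0 k k<n) (C-below-prime k (ℕ.<⇒≤ k<n)) ⟩
    0ℤ - -1ℤ ^ k                                 ≡⟨ trans (ℤ.+-identityˡ _) (sym (-1^-suc k)) ⟩
    -1ℤ ^ suc k                                  ∎
    where
    open ≡-mod-Reasoning P
    difference : + (n C suc k) ≡ + (p C suc k) - + (n C k)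
    difference = trans (identity (+ (n C k)) (+ (n C suc k))) (cong (_- + (n C k)) (sym (pascal n k)))
      where identity : ∀ a b → b ≡ a + b - a
            identity = solve-∀

  C-above-prime : ∀ k → k < p → + ((p ℕ.+ k) C k) ≡ 1ℤ mod P
  C-above-prime zero    _   = mod-refl
  C-above-prime (suc k) k<p = *-cancelˡ-mod-p (s≤s z≤n) k<p (begin
    + suc k * + ((p ℕ.+ suc k) C suc k)       ≡⟨ cong (λ m → + suc k * + (m C suc k)) (ℕ.+-suc p k) ⟩
    + suc k * + (suc (p ℕ.+ k) C suc k)       ≡⟨ pos-*-≡ (suc k) _ (suc (p ℕ.+ k)) ((p ℕ.+ k) C k) (C-absorb (p ℕ.+ k) k) ⟩
    + suc (p ℕ.+ k) * + ((p ℕ.+ k) C k)       ≈⟨ *-cong p+k+1≡k+1 (C-above-prime k (ℕ.<-trans (ℕ.n<1+n k) k<p)) ⟩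
    + suc k * 1ℤ                              ∎)
    where
    open ≡-mod-Reasoning P
    p+k+1≡k+1 : + suc (p ℕ.+ k) ≡ + suc k mod P
    p+k+1≡k+1 = ≡-mod 1ℤ (trans (cong (λ m → + suc m) (ℕ.+-comm p k)) (trans (ℤ.pos-+ (suc k) p) (cong (λ y → + suc k + y) (sym (ℤ.*-identityˡ P)))))

  suc-*-C-prime : ∀ k → k ≤ n → + suc k * + (p C suc k) ≡ P * -1ℤ ^ k mod (P * P)
  suc-*-C-prime k k≤n = begin
    + suc k * + (p C suc k)   ≡⟨ pos-*-≡ (suc k) _ p (n C k) (C-absorb n k) ⟩
    P * + (n C k)             ≈⟨ *-cong-scaled P (C-below-prime k k≤n) ⟩
    P * -1ℤ ^ k               ∎
    where open ≡-mod-Reasoning (P * P)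

  fermat : ∀ x → (+ x) ^ p ≡ + x mod P
  fermat zero    = mod-refl
  fermat (suc x) = begin
    (1ℤ + + x) ^ p                                            ≡⟨ binomial-theorem p (+ x) ⟩
    ∑ (suc p) F                                               ≡⟨ Sum.⨁-head p F ⟩
    1ℤ + (∑ n (λ i → F (suc i)) + F p)                        ≈⟨ +-cong (mod-refl {a = 1ℤ}) (+-cong inner-terms≡0 (mod-reflexive last-term)) ⟩
    1ℤ + (0ℤ + (+ x) ^ p)                                     ≈⟨ +-cong (mod-refl {a = 1ℤ}) (+-cong (mod-refl {a = 0ℤ}) (fermat x)) ⟩
    1ℤ + (0ℤ + + x)                                           ≡⟨ cong (λ y → 1ℤ + y) (ℤ.+-identityˡ (+ x)) ⟩
    1ℤ + + x                                                  ∎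
    where
    open ≡-mod-Reasoning P
    F : ℕ → ℤ
    F k = + (p C k) * (+ x) ^ k
    last-term : F p ≡ (+ x) ^ p
    last-term = trans (cong (λ c → + c * (+ x) ^ p) (nCn≡1 p)) (ℤ.*-identityˡ _)
    inner-terms≡0 : ∑ n (λ i → F (suc i)) ≡ 0ℤ mod P
    inner-terms≡0 = mod-trans (∑-cong-mod n (λ i i<n → mod-trans (*-congʳ ((+ x) ^ suc i) (C-prime≡0 i i<n)) (mod-reflexive (ℤ.*-zeroˡ ((+ x) ^ suc i)))))
                              (mod-reflexive (Sum.⨁-ε n))

  fermat-unit : ∀ {x} → 0 < x → x < p → (+ x) ^ n ≡ 1ℤ mod P
  fermat-unit {x} 0<x x<p = *-cancelˡ-mod-p 0<x x<p (mod-trans (fermat x) (mod-reflexive (sym (ℤ.*-identityʳ (+ x)))))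

  -- Σ_k (−1)^k C(n,k) k^n = (−1)^n n! modulo p: C(n,k) ≡ (−1)^k cancels the signs and
  -- k^n ≡ 1 for 0 < k ≤ n, leaving n ≡ −1.
  wilson-signed : -1ℤ ^ n * + (n !) ≡ -1ℤ mod P
  wilson-signed = begin
    -1ℤ ^ n * + (n !)                                           ≡⟨ alternating-top n 0ℤ ⟨
    alternating n n 0ℤ                                          ≈⟨ ∑-cong-mod (suc n) (λ k k≤n → signs-cancel k (ℕ.≤-pred k≤n)) ⟩
    ∑ (suc n) E                                                 ≡⟨ Sum.⨁-head n E ⟩
    E 0 + ∑ n (λ i → E (suc i))                                 ≈⟨ +-cong (mod-reflexive zero-power) (∑-cong-mod n (λ i i<n → fermat-unit (s≤s z≤n) (s≤s i<n))) ⟩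
    0ℤ + ∑ n (λ _ → 1ℤ)                                         ≡⟨ trans (ℤ.+-identityˡ _) (count n) ⟩
    + n                                                         ≈⟨ ≡-mod 1ℤ (trans (identity (+ n)) (cong (λ y → -1ℤ + 1ℤ * y) (sym (ℤ.pos-+ 1 n)))) ⟩
    -1ℤ                                                         ∎
    where
    open ≡-mod-Reasoning P
    E : ℕ → ℤ
    E k = (+ k) ^ n
    signs-cancel : ∀ k → k ≤ n → -1ℤ ^ k * (+ (n C k) * (+ k + 0ℤ) ^ n) ≡ E k mod P
    signs-cancel k k≤n = mod-trans (*-congˡ (-1ℤ ^ k) (*-congʳ _ (C-below-prime k k≤n))) (mod-reflexive signs-square)
      where
      signs-square : -1ℤ ^ k * (-1ℤ ^ k * (+ k + 0ℤ) ^ n) ≡ E k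
      signs-square = trans (sym (ℤ.*-assoc (-1ℤ ^ k) _ _)) (trans (cong (_* (+ k + 0ℤ) ^ n) (-1^-square k))
                       (trans (ℤ.*-identityˡ _) (cong (_^ n) (ℤ.+-identityʳ (+ k)))))
    zero-power : 0ℤ ^ n ≡ 0ℤ
    zero-power = subst (λ m → 0ℤ ^ m ≡ 0ℤ) (ℕ.m+[n∸m]≡n 1≤n) (ℤ.*-zeroˡ (0ℤ ^ (n ℕ.∸ 1)))
    count : ∀ m → ∑ m (λ _ → 1ℤ) ≡ + m
    count zero    = refl
    count (suc m) = trans (cong (_+ 1ℤ) (count m)) (trans (sym (ℤ.pos-+ m 1)) (cong +_ (ℕ.+-comm m 1)))
    identity : ∀ x → x ≡ -1ℤ + 1ℤ * (1ℤ + x)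
    identity = solve-∀

module OddPrime (h : ℕ) (prime : Prime (suc (h ℕ.+ h))) where

  open import Data.Nat using (_∸_)
  open import Data.Integer using (_+_; _*_; -_; _-_; _^_)
  open import Data.Integer.Tactic.RingSolver using (solve-∀)

  open ModPrime (h ℕ.+ h) prime public

  private
    complement : ∀ a b → a ℕ.+ b ≡ p → + b ≡ P - + a
    complement a b a+b≡p = trans (identity (+ a) (+ b)) (cong (_- + a) (trans (sym (ℤ.pos-+ a b)) (cong +_ a+b≡p)))
      where identity : ∀ a b → b ≡ a + b - a
            identity = solve-∀

    reflect-in-2h : ∀ j → j < h ℕ.+ h → + suc (h ℕ.+ h ∸ suc j) ≡ P - + suc j
    reflect-in-2h j j<2h = complement (suc j) _ (trans (ℕ.+-suc (suc j) _) (cong suc (ℕ.m+[n∸m]≡n j<2h)))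

    reflect-in-h : ∀ j → j < h → + (h ℕ.+ suc (h ∸ suc j)) ≡ P - + suc j
    reflect-in-h j j<h = complement (suc j) _ (trans (identity (suc j) h (h ∸ suc j)) (cong (λ x → suc (h ℕ.+ x)) (ℕ.m+[n∸m]≡n j<h)))
      where identity : ∀ a b c → a ℕ.+ (b ℕ.+ suc c) ≡ suc (b ℕ.+ (a ℕ.+ c))
            identity = Data.Nat.Tactic.RingSolver.solve-∀
              where import Data.Nat.Tactic.RingSolver

  wilson : + ((h ℕ.+ h) !) ≡ -1ℤ mod P
  wilson = mod-trans (mod-reflexive (sym (trans (cong (_* + ((h ℕ.+ h) !)) (-1^-even h)) (ℤ.*-identityˡ (+ ((h ℕ.+ h) !)))))) wilson-signed

  factorial-pairs : + ((h ℕ.+ h) !) ≡ ∏ h (λ j → + suc j * (P - + suc j))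
  factorial-pairs = begin
    + ((h ℕ.+ h) !)                                      ≡⟨ factorial-∏ (h ℕ.+ h) ⟩
    ∏ (h ℕ.+ h) (λ j → + suc j)                          ≡⟨ Product.⨁-pairs-even h (λ j → + suc j) ⟩
    ∏ h (λ j → + suc j * + suc (h ℕ.+ h ∸ suc j))        ≡⟨ Product.⨁-cong h (λ j j<h → cong (+ suc j *_) (reflect-in-2h j (ℕ.<-≤-trans j<h (ℕ.m≤m+n h h)))) ⟩
    ∏ h (λ j → + suc j * (P - + suc j))                  ∎
    where open ≡-Reasoning

  ∏-negated-squares : ∏ h (λ j → - (+ suc j * + suc j)) ≡ -1ℤ ^ h * (+ (h !) * + (h !))
  ∏-negated-squares = begin
    ∏ h (λ j → - (+ suc j * + suc j))                    ≡⟨ ∏-neg h _ ⟩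
    -1ℤ ^ h * ∏ h (λ j → + suc j * + suc j)              ≡⟨ cong (-1ℤ ^ h *_) (Product.⨁-distrib h _ _) ⟩
    -1ℤ ^ h * (∏ h (λ j → + suc j) * ∏ h (λ j → + suc j)) ≡⟨ cong (λ x → -1ℤ ^ h * (x * x)) (factorial-∏ h) ⟨
    -1ℤ ^ h * (+ (h !) * + (h !))                        ∎
    where open ≡-Reasoning

  half-factorial-square : + (h !) * + (h !) ≡ - (-1ℤ ^ h) mod P
  half-factorial-square = begin
    F * F                                       ≡⟨ sign-twice (F * F) ⟨
    s * (s * (F * F))                           ≡⟨ cong (s *_) ∏-negated-squares ⟨
    s * ∏ h (λ j → - (+ suc j * + suc j))       ≈⟨ *-congˡ s (∏-cong-mod h (λ j _ → ≡-mod (+ suc j) (identity (+ suc j) P))) ⟨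
    s * ∏ h (λ j → + suc j * (P - + suc j))     ≡⟨ cong (s *_) factorial-pairs ⟨
    s * + ((h ℕ.+ h) !)                         ≈⟨ *-congˡ s wilson ⟩
    s * -1ℤ                                     ≡⟨ trans (ℤ.*-comm s -1ℤ) (ℤ.-1*i≡-i s) ⟩
    - s                                         ∎
    where
    open ≡-mod-Reasoning P
    F : ℤ
    F = + (h !)
    s : ℤ
    s = -1ℤ ^ h
    sign-twice : ∀ x → s * (s * x) ≡ x
    sign-twice x = trans (sym (ℤ.*-assoc s s x)) (trans (cong (_* x) (-1^-square h)) (ℤ.*-identityˡ x))
    identity : ∀ a P → a * (P - a) ≡ - (a * a) + a * P
    identity = solve-∀

  C-above-prime² : + ((p ℕ.+ (h ℕ.+ h)) C (h ℕ.+ h)) ≡ 1ℤ mod (P * P)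
  C-above-prime² = !-*-cancelˡ-mod-p² (h ℕ.+ h) ℕ.≤-refl (begin
    + ((h ℕ.+ h) !) * + ((p ℕ.+ (h ℕ.+ h)) C (h ℕ.+ h))  ≡⟨ rising-factorial p (h ℕ.+ h) ⟩
    ∏ (h ℕ.+ h) f                                        ≡⟨ Product.⨁-pairs-even h f ⟩
    ∏ h (λ j → f j * f (h ℕ.+ h ∸ suc j))                ≡⟨ Product.⨁-cong h (λ j j<h → cong₂ _*_ (ℤ.pos-+ p (suc j)) (reflected j j<h)) ⟩
    ∏ h (λ j → (P + a j) * (P + (P - a j)))              ≈⟨ ∏-cong-mod h (λ j _ → ≡-mod (+ 2) (identity P (a j))) ⟩
    ∏ h (λ j → a j * (P - a j))                          ≡⟨ factorial-pairs ⟨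
    + ((h ℕ.+ h) !)                                      ≡⟨ ℤ.*-identityʳ _ ⟨
    + ((h ℕ.+ h) !) * 1ℤ                                 ∎)
    where
    open ≡-mod-Reasoning (P * P)
    a f : ℕ → ℤ
    a j = + suc j
    f j = + (p ℕ.+ suc j)
    reflected : ∀ j → j < h → f (h ℕ.+ h ∸ suc j) ≡ P + (P - a j)
    reflected j j<h = trans (ℤ.pos-+ p _) (cong (λ x → P + x) (reflect-in-2h j (ℕ.<-≤-trans j<h (ℕ.m≤m+n h h))))
    identity : ∀ P a → (P + a) * (P + (P - a)) ≡ a * (P - a) + + 2 * (P * P)
    identity = solve-∀

  central-C-product : + ((p ℕ.+ h) C h) * + ((h ℕ.+ h) C h) ≡ -1ℤ ^ h mod (P * P)
  central-C-product = !-*-cancelˡ-mod-p² h h<p (!-*-cancelˡ-mod-p² h h<p (begin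
    F * (F * (X * Y))                                    ≡⟨ shuffle F X Y ⟩
    (F * X) * (F * Y)                                    ≡⟨ cong₂ _*_ (rising-factorial p h) (rising-factorial h h) ⟩
    ∏ h (λ j → + (p ℕ.+ suc j)) * ∏ h (λ j → + (h ℕ.+ suc j))  ≡⟨ cong₂ _*_ (Product.⨁-cong h (λ j _ → ℤ.pos-+ p (suc j))) reversed ⟩
    ∏ h (λ j → P + a j) * ∏ h (λ j → P - a j)            ≡⟨ Product.⨁-distrib h _ _ ⟨
    ∏ h (λ j → (P + a j) * (P - a j))                    ≈⟨ ∏-cong-mod h (λ j _ → ≡-mod 1ℤ (difference-of-squares P (a j))) ⟩
    ∏ h (λ j → - (a j * a j))                            ≡⟨ ∏-negated-squares ⟩
    -1ℤ ^ h * (F * F)                                    ≡⟨ shuffle′ (-1ℤ ^ h) F ⟩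
    F * (F * -1ℤ ^ h)                                    ∎))
    where
    open ≡-mod-Reasoning (P * P)
    F : ℤ
    F = + (h !)
    X : ℤ
    X = + ((p ℕ.+ h) C h)
    Y : ℤ
    Y = + ((h ℕ.+ h) C h)
    a : ℕ → ℤ
    a j = + suc j
    h<p : h < p
    h<p = s≤s (ℕ.m≤m+n h h)
    reversed : ∏ h (λ j → + (h ℕ.+ suc j)) ≡ ∏ h (λ j → P - a j)
    reversed = trans (sym (Product.⨁-reverse h (λ j → + (h ℕ.+ suc j)))) (Product.⨁-cong h (λ j j<h → reflect-in-h j j<h))
    shuffle : ∀ F X Y → F * (F * (X * Y)) ≡ (F * X) * (F * Y)
    shuffle = solve-∀
    shuffle′ : ∀ s F → s * (F * F) ≡ F * (F * s)
    shuffle′ = solve-∀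
    difference-of-squares : ∀ P a → (P + a) * (P - a) ≡ - (a * a) + 1ℤ * (P * P)
    difference-of-squares = solve-∀

  C-prime-half : + (p C h) ≡ + 2 * P * -1ℤ ^ h mod (P * P)
  C-prime-half = subst (λ k → + (p C k) ≡ + 2 * P * -1ℤ ^ k mod (P * P)) (ℕ.m+[n∸m]≡n 1≤h) (C-prime-suc (h ∸ 1) (ℕ.m+[n∸m]≡n 1≤h))
    where
    1≤h : 1 ≤ h
    1≤h = positive-half h 1≤n
      where positive-half : ∀ m → 1 ≤ m ℕ.+ m → 1 ≤ m
            positive-half (suc _) _ = s≤s z≤n
    C-prime-suc : ∀ j → suc j ≡ h → + (p C suc j) ≡ + 2 * P * -1ℤ ^ suc j mod (P * P)
    C-prime-suc j refl = begin
      X                                    ≡⟨ identity (+ j) X ⟩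
      P * X - + 2 * (+ suc j * X)          ≈⟨ sub-cong (*-cong-scaled P (C-prime≡0 j j<2h)) (*-congˡ (+ 2) (suc-*-C-prime j (ℕ.<⇒≤ j<2h))) ⟩
      P * 0ℤ - + 2 * (P * -1ℤ ^ j)         ≡⟨ identity′ P (-1ℤ ^ j) ⟩
      + 2 * P * (-1ℤ * -1ℤ ^ j)            ∎
      where
      open ≡-mod-Reasoning (P * P)
      X : ℤ
      X = + (p C suc j)
      j<2h : j < suc j ℕ.+ suc j
      j<2h = s≤s (ℕ.m≤m+n j (suc j))
      identity : ∀ j X → X ≡ (1ℤ + (1ℤ + j) + (1ℤ + j)) * X - + 2 * ((1ℤ + j) * X)
      identity = solve-∀
      identity′ : ∀ P s → P * 0ℤ - + 2 * (P * s) ≡ + 2 * P * (-1ℤ * s)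
      identity′ = solve-∀

  τ-scaled : ∀ k → k < h ℕ.+ h → + suc (k ℕ.+ k) * + τ p k ≡ + (p C suc k) mod (P * P)
  τ-scaled k k<2h = mod-trans (mod-reflexive (pos-*-≡ (suc (k ℕ.+ k)) (τ p k) ((p ℕ.+ k) C k) (p C suc k) (τ-odd-multiple p k)))
                              (≡1*≡0-mod² (C-above-prime k (ℕ.m<n⇒m<1+n k<2h)) (C-prime≡0 k k<2h))

  τ-first : τ p 0 ≡ p
  τ-first = trans (ℕ.*-identityˡ _) (trans (cong (_C 1) (ℕ.+-identityʳ p)) (nC1≡n p))

  τ-last : + τ p (h ℕ.+ h) ≡ -1ℤ - + 2 * P mod (P * P)
  τ-last = mod-trans (*-cancel-1+mu P (- + 2) (mod-trans (mod-reflexive (negate (+ (h ℕ.+ h)) t)) (-‿cong scaled))) (mod-reflexive (tidy P))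
    where
    open ≡-mod-Reasoning (P * P)
    n : ℕ
    n = h ℕ.+ h
    t : ℤ
    t = + τ p n
    scaled : + suc (n ℕ.+ n) * t ≡ 1ℤ mod (P * P)
    scaled = begin
      + suc (n ℕ.+ n) * t                          ≡⟨ pos-*-≡ (suc (n ℕ.+ n)) (τ p n) ((p ℕ.+ n) C n) (p C p) (τ-odd-multiple p n) ⟩
      + ((p ℕ.+ n) C n) * + (p C p)                ≡⟨ cong (λ c → + ((p ℕ.+ n) C n) * + c) (nCn≡1 p) ⟩
      + ((p ℕ.+ n) C n) * 1ℤ                       ≡⟨ ℤ.*-identityʳ _ ⟩
      + ((p ℕ.+ n) C n)                            ≈⟨ C-above-prime² ⟩
      1ℤ                                           ∎
    negate : ∀ n t → (1ℤ + (1ℤ + n) * - + 2) * t ≡ - ((1ℤ + (n + n)) * t)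
    negate = solve-∀
    tidy : ∀ P → -1ℤ - P * - + 2 * -1ℤ ≡ -1ℤ - + 2 * P
    tidy = solve-∀

  τ-middle : + τ p h ≡ + 2 * -1ℤ ^ h - + 2 * P * -1ℤ ^ h mod (P * P)
  τ-middle = mod-trans (*-cancel-1+mu P 1ℤ doubled) (mod-reflexive (tidy P (-1ℤ ^ h)))
    where
    open ≡-mod-Reasoning (P * P)
    doubled : (1ℤ + P * 1ℤ) * + τ p h ≡ + 2 * -1ℤ ^ h mod (P * P)
    doubled = begin
      (1ℤ + P * 1ℤ) * + τ p h                              ≡⟨ double (+ h) (+ τ p h) ⟩
      + 2 * (+ suc h * + τ p h)                            ≡⟨ cong (+ 2 *_) (pos-*-≡ (suc h) (τ p h) ((p ℕ.+ h) C h) ((h ℕ.+ h) C h) (τ-central h)) ⟩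
      + 2 * (+ ((p ℕ.+ h) C h) * + ((h ℕ.+ h) C h))        ≈⟨ *-congˡ (+ 2) central-C-product ⟩
      + 2 * -1ℤ ^ h                                        ∎
      where double : ∀ h t → (1ℤ + (1ℤ + (h + h)) * 1ℤ) * t ≡ + 2 * ((1ℤ + h) * t)
            double = solve-∀
    tidy : ∀ P s → + 2 * s - P * 1ℤ * (+ 2 * s) ≡ + 2 * s - + 2 * P * s
    tidy = solve-∀

  -- Used with t = τ p k, t′ = τ p (2h − k), bᵢ = C(p, k + i) and s = (−1)^k.
  pair-identity : ∀ Q k {t t′ b₀ b₁ s} →
    (1ℤ + (k + k)) * t ≡ b₁ mod (Q * Q) →
    (Q + Q - (1ℤ + (k + k))) * t′ ≡ b₀ mod (Q * Q) →
    t′ ≡ 0ℤ mod Q →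
    (1ℤ + k) * b₁ ≡ Q * s mod (Q * Q) →
    k * b₀ ≡ - (Q * s) mod (Q * Q) →
    (1ℤ + (k + k)) * (t + t′) ≡ (1ℤ + (k + k)) * - (b₀ + b₁) mod (Q * Q)
  pair-identity Q k {t} {t′} {b₀} {b₁} {s} Kt≡b₁ K′t′≡b₀ t′≡0 b₁-absorbed b₀-absorbed = begin
    (1ℤ + (k + k)) * (t + t′)                                  ≡⟨ expand-lhs Q k t t′ ⟩
    (1ℤ + (k + k)) * t + (+ 2 * (Q * t′) - (Q + Q - (1ℤ + (k + k))) * t′)
        ≈⟨ +-cong Kt≡b₁ (sub-cong (*-congˡ (+ 2) (*-cong-scaled Q t′≡0)) K′t′≡b₀) ⟩
    b₁ + (+ 2 * (Q * 0ℤ) - b₀)                                 ≡⟨ middle Q s b₀ b₁ ⟩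
    - (+ 2 * - (Q * s) + b₀) - (+ 2 * (Q * s) - b₁)
        ≈⟨ sub-cong (-‿cong (+-cong (*-congˡ (+ 2) b₀-absorbed) mod-refl)) (sub-cong (*-congˡ (+ 2) b₁-absorbed) mod-refl) ⟨
    - (+ 2 * (k * b₀) + b₀) - (+ 2 * ((1ℤ + k) * b₁) - b₁)     ≡⟨ expand-rhs k b₀ b₁ ⟩
    (1ℤ + (k + k)) * - (b₀ + b₁)                               ∎
    where
    open ≡-mod-Reasoning (Q * Q)
    expand-lhs : ∀ Q k t t′ → (1ℤ + (k + k)) * (t + t′) ≡ (1ℤ + (k + k)) * t + (+ 2 * (Q * t′) - (Q + Q - (1ℤ + (k + k))) * t′)
    expand-lhs = solve-∀
    middle : ∀ Q s b₀ b₁ → b₁ + (+ 2 * (Q * 0ℤ) - b₀) ≡ - (+ 2 * - (Q * s) + b₀) - (+ 2 * (Q * s) - b₁)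
    middle = solve-∀
    expand-rhs : ∀ k b₀ b₁ → - (+ 2 * (k * b₀) + b₀) - (+ 2 * ((1ℤ + k) * b₁) - b₁) ≡ (1ℤ + (k + k)) * - (b₀ + b₁)
    expand-rhs = solve-∀

  τ-pair : ∀ i → i < h → + τ p i + + τ p (h ℕ.+ h ∸ i) ≡ - (+ (p C i) + + (p C suc i)) mod (P * P)
  τ-pair zero    _ = begin
    + τ p 0 + + τ p (h ℕ.+ h)                  ≈⟨ +-cong (mod-reflexive (cong +_ τ-first)) τ-last ⟩
    P + (-1ℤ - + 2 * P)                        ≡⟨ identity P ⟩
    - (1ℤ + P)                                 ≡⟨ cong (λ c → - (1ℤ + + c)) (nC1≡n p) ⟨
    - (+ (p C 0) + + (p C 1))                  ∎
    where
    open ≡-mod-Reasoning (P * P)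
    identity : ∀ P → P + (-1ℤ - + 2 * P) ≡ - (1ℤ + P)
    identity = solve-∀
  τ-pair (suc j) k<h = *-cancelˡ-mod-p² {suc (k ℕ.+ k)} (s≤s z≤n) K<p
    (pair-identity P (+ k) {+ τ p k} {t′} {+ (p C k)} {+ (p C suc k)} { -1ℤ ^ k }
      (τ-scaled k k<2h) K′t′≡b₀ t′≡0 (suc-*-C-prime k (ℕ.<⇒≤ k<2h)) b₀-absorbed)
    where
    k : ℕ
    k = suc j
    k′ : ℕ
    k′ = h ℕ.+ h ∸ k
    K<p : suc (k ℕ.+ k) < p
    K<p = s≤s (ℕ.+-mono-< k<h k<h)
    t′ : ℤ
    t′ = + τ p k′
    k≤2h : k ≤ h ℕ.+ h
    k≤2h = ℕ.≤-trans (ℕ.<⇒≤ k<h) (ℕ.m≤m+n h h)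
    k<2h : k < h ℕ.+ h
    k<2h = ℕ.<-≤-trans k<h (ℕ.m≤m+n h h)
    k+k′≡2h : k ℕ.+ k′ ≡ h ℕ.+ h
    k+k′≡2h = ℕ.m+[n∸m]≡n k≤2h
    k′<2h : k′ < h ℕ.+ h
    k′<2h = ℕ.∸-monoʳ-< (s≤s z≤n) k≤2h
    K′ : + suc (k′ ℕ.+ k′) ≡ P + P - (1ℤ + (+ k + + k))
    K′ = trans (identity (+ k) (+ k′)) (cong (λ m → + suc m + + suc m - (1ℤ + (+ k + + k))) k+k′≡2h)
      where identity : ∀ k k′ → 1ℤ + (k′ + k′) ≡ (1ℤ + (k + k′)) + (1ℤ + (k + k′)) - (1ℤ + (k + k))
            identity = solve-∀
    reflected : p C suc k′ ≡ p C k
    reflected = sym (subst (λ m → m C k ≡ m C suc k′) (trans (ℕ.+-suc k k′) (cong suc k+k′≡2h)) (C-symmetric k (suc k′)))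
    K′t′≡b₀ : (P + P - (1ℤ + (+ k + + k))) * t′ ≡ + (p C k) mod (P * P)
    K′t′≡b₀ = subst₂ (λ K c → K * t′ ≡ + c mod (P * P)) K′ reflected (τ-scaled k′ k′<2h)
    t′≡0 : t′ ≡ 0ℤ mod P
    t′≡0 = *-cancelˡ-mod-p (s≤s z≤n) K<p (begin
      K * t′                                   ≡⟨ identity P K t′ ⟩
      (+ 2 * t′) * P - (P + P - K) * t′        ≈⟨ sub-cong (multiple≡0 (+ 2 * t′)) (mod-trans (mod-divisor {P} {P} K′t′≡b₀) (C-prime≡0 j (ℕ.<-trans (ℕ.n<1+n j) k<2h))) ⟩
      0ℤ - 0ℤ                                  ≡⟨ ℤ.*-zeroʳ K ⟨
      K * 0ℤ                                   ∎)
      where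
      open ≡-mod-Reasoning P
      K : ℤ
      K = 1ℤ + (+ k + + k)
      identity : ∀ P K t → K * t ≡ (+ 2 * t) * P - (P + P - K) * t
      identity = solve-∀
    b₀-absorbed : + k * + (p C k) ≡ - (P * -1ℤ ^ k) mod (P * P)
    b₀-absorbed = mod-trans (suc-*-C-prime j (ℕ.<⇒≤ (ℕ.<-trans (ℕ.n<1+n j) k<2h)))
                    (mod-reflexive (trans (identity P (-1ℤ ^ j)) (cong (λ x → - (P * x)) (sym (-1^-suc j)))))
      where identity : ∀ P s → P * s ≡ - (P * - s)
            identity = solve-∀

  row-halves : + (2 ℕ.^ p) ≡ 1ℤ + + (p C h) + ∑ h (λ i → + (p C i) + + (p C suc i))
  row-halves = begin
    + (2 ℕ.^ p)                                    ≡⟨ pos-^ 2 p ⟩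
    (1ℤ + 1ℤ) ^ p                                  ≡⟨ binomial-theorem p 1ℤ ⟩
    ∑ (suc p) (λ k → c k * 1ℤ ^ k)                 ≡⟨ Sum.⨁-cong (suc p) (λ k _ → trans (cong (c k *_) (ℤ.^-zeroˡ k)) (ℤ.*-identityʳ (c k))) ⟩
    ∑ (suc p) c                                    ≡⟨ cong (λ m → ∑ m c) (cong suc (ℕ.+-suc h h)) ⟨
    ∑ (suc h ℕ.+ suc h) c                          ≡⟨ Sum.⨁-pairs-even (suc h) c ⟩
    ∑ (suc h) (λ i → c i + c (suc h ℕ.+ suc h ∸ suc i))  ≡⟨ Sum.⨁-cong (suc h) (λ i i≤h → cong (λ x → c i + x) (symmetric i i≤h)) ⟩
    ∑ (suc h) (λ i → c i + c i)                    ≡⟨ Sum.⨁-distrib (suc h) c c ⟩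
    ∑ (suc h) c + ∑ (suc h) c                      ≡⟨ cong (λ x → ∑ (suc h) c + x) (Sum.⨁-head h c) ⟩
    ∑ h c + c h + (1ℤ + ∑ h (λ i → c (suc i)))     ≡⟨ regroup (∑ h c) (c h) (∑ h (λ i → c (suc i))) ⟩
    1ℤ + c h + (∑ h c + ∑ h (λ i → c (suc i)))     ≡⟨ cong (λ x → 1ℤ + c h + x) (Sum.⨁-distrib h c (λ i → c (suc i))) ⟨
    1ℤ + c h + ∑ h (λ i → c i + c (suc i))         ∎
    where
    open ≡-Reasoning
    c : ℕ → ℤ
    c i = + (p C i)
    symmetric : ∀ i → i < suc h → c (suc h ℕ.+ suc h ∸ suc i) ≡ c i
    symmetric i (s≤s i≤h) = cong +_ (trans (cong (λ m → p C (m ∸ i)) (ℕ.+-suc h h)) (sym (nCk≡nC[n∸k] (ℕ.≤-trans i≤h (ℕ.m≤n+m h (suc h))))))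
    regroup : ∀ a b c → a + b + (1ℤ + c) ≡ 1ℤ + b + (a + c)
    regroup = solve-∀

  ∑-τ : ∑ p (λ k → + τ p k) ≡ + 2 * -1ℤ ^ h - + (2 ℕ.^ p) + 1ℤ mod (P * P)
  ∑-τ = begin
    ∑ p f                                                       ≡⟨ Sum.⨁-pairs-odd h f ⟩
    f h + ∑ h (λ i → f i + f (h ℕ.+ h ∸ i))                     ≈⟨ +-cong τ-middle (∑-cong-mod h τ-pair) ⟩
    (+ 2 * s - + 2 * P * s) + ∑ h (λ i → - (c i + c (suc i)))   ≡⟨ cong (λ x → (+ 2 * s - + 2 * P * s) + x) (∑-neg h _) ⟩
    (+ 2 * s - + 2 * P * s) + - Σc                              ≈⟨ +-cong (sub-cong (mod-refl {a = + 2 * s}) (mod-sym C-prime-half)) (mod-refl {a = - Σc}) ⟩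
    (+ 2 * s - c h) + - Σc                                      ≡⟨ regroup (+ 2 * s) (c h) Σc ⟩
    + 2 * s - (1ℤ + c h + Σc) + 1ℤ                              ≡⟨ cong (λ x → + 2 * s - x + 1ℤ) row-halves ⟨
    + 2 * s - + (2 ℕ.^ p) + 1ℤ                                  ∎
    where
    open ≡-mod-Reasoning (P * P)
    s : ℤ
    s = -1ℤ ^ h
    f c : ℕ → ℤ
    f k = + τ p k
    c i = + (p C i)
    Σc : ℤ
    Σc = ∑ h (λ i → c i + c (suc i))
    regroup : ∀ a b Σ → a - b + - Σ ≡ a - (1ℤ + b + Σ) + 1ℤ
    regroup = solve-∀

  partial-∑-S : + sumFrom1 (h ℕ.+ h) S ≡ + 2 * -1ℤ ^ h - + (2 ℕ.^ p) mod (P * P)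
  partial-∑-S = begin
    + sumFrom1 (h ℕ.+ h) S                                   ≡⟨ identity _ ⟩
    (1ℤ + + sumFrom1 (h ℕ.+ h) S) - 1ℤ                       ≡⟨ cong (λ x → (1ℤ + x) - 1ℤ) (sumFrom1-∑ (h ℕ.+ h) S) ⟩
    (+ S 0 + ∑ (h ℕ.+ h) (λ n → + S (suc n))) - 1ℤ           ≡⟨ cong (_- 1ℤ) (Sum.⨁-head (h ℕ.+ h) (λ n → + S n)) ⟨
    ∑ p (λ n → + S n) - 1ℤ                                   ≡⟨ cong (_- 1ℤ) (∑-S p) ⟩
    ∑ p (λ k → + τ p k) - 1ℤ                                 ≈⟨ sub-cong ∑-τ (mod-refl {a = 1ℤ}) ⟩
    + 2 * -1ℤ ^ h - + (2 ℕ.^ p) + 1ℤ - 1ℤ                    ≡⟨ identity′ (+ 2 * -1ℤ ^ h) (+ (2 ℕ.^ p)) ⟩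
    + 2 * -1ℤ ^ h - + (2 ℕ.^ p)                              ∎
    where
    open ≡-mod-Reasoning (P * P)
    identity : ∀ x → x ≡ (1ℤ + x) - 1ℤ
    identity = solve-∀
    identity′ : ∀ a b → a - b + 1ℤ - 1ℤ ≡ a - b
    identity′ = solve-∀

-- Stated for p = 2h′ + 3, so that (−1) %ℕ p computes and legendre unfolds definitionally.
module LegendreMinusOne (h′ : ℕ) (prime : Prime (suc (suc h′ ℕ.+ suc h′))) where

  open import Data.Integer using (_+_; _*_; -_; _-_; _^_)
  open import Data.Integer.Tactic.RingSolver using (solve-∀)
  open import Data.Bool using (Bool; true; false; if_then_else_; T)
  open import Data.Bool.ListAction using (any)
  open import Data.List using (upTo)
  import Data.List.Relation.Unary.Any as Any
  open import Data.List.Relation.Unary.Any.Properties using (any⁺; any⁻)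
  open import Data.List.Membership.Propositional using (find)
  open import Data.List.Membership.Propositional.Properties using (∈-upTo⁺; ∈-upTo⁻)
  open import Data.Nat.DivMod using (_%_; _/_; m≡m%n+[m/n]*n; m%n<n; %-distribˡ-*)
  open import Data.Unit using (tt)

  open OddPrime (suc h′) prime
  private
    h : ℕ
    h = suc h′

    -1-residue : ℕ → Bool
    -1-residue x = ((x ℕ.* x) % p) ℕ.≡ᵇ (h ℕ.+ h)

  legendre-unfold : legendre -1ℤ p {{prime⇒nonZero prime}} ≡ (if any -1-residue (upTo p) then 1ℤ else -1ℤ)
  legendre-unfold = refl

  m≡m%p : ∀ m → + m ≡ + (m % p) mod P
  m≡m%p m = ≡-mod (+ (m / p)) (trans (cong +_ (m≡m%n+[m/n]*n m p)) (trans (ℤ.pos-+ (m % p) _) (cong (λ x → + (m % p) + x) (ℤ.pos-* (m / p) p))))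

  ≡-1⇒%≡p-1 : ∀ m → + m ≡ -1ℤ mod P → m % p ≡ h ℕ.+ h
  ≡-1⇒%≡p-1 m m≡-1 = ℕ.suc-injective (ℕ.≤-antisym (m%n<n m p) (ℕ.∣⇒≤ p∣1+r))
    where
    p∣1+r : p ℕ.∣ suc (m % p)
    p∣1+r = ≡0-mod⇒∣ (begin
      + suc (m % p)         ≡⟨ ℤ.pos-+ 1 (m % p) ⟩
      1ℤ + + (m % p)        ≈⟨ +-cong (mod-refl {a = 1ℤ}) (mod-trans (mod-sym (m≡m%p m)) m≡-1) ⟩
      1ℤ + -1ℤ              ≡⟨⟩
      0ℤ                    ∎)
      where open ≡-mod-Reasoning P

  residue-if-even : -1ℤ ^ h ≡ 1ℤ → T (any -1-residue (upTo p))
  residue-if-even even = any⁺ -1-residue (Any.map (λ { refl → is-root }) (∈-upTo⁺ (m%n<n (h !) p)))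
    where
    is-root : T (-1-residue (h ! % p))
    is-root = ℕ.≡⇒≡ᵇ _ _ (trans (sym (%-distribˡ-* (h !) (h !) p))
                (≡-1⇒%≡p-1 _ (mod-trans (mod-reflexive (ℤ.pos-* (h !) (h !))) (mod-trans half-factorial-square (mod-reflexive (cong -_ even))))))

  no-residue-if-odd : -1ℤ ^ h ≡ -1ℤ → T (any -1-residue (upTo p)) → ⊥
  no-residue-if-odd odd residue with find (any⁻ -1-residue (upTo p) residue)
  ... | x , x∈upTo , x-root = ℕ.<⇒≱ 2<p (ℕ.∣⇒≤ (≡0-mod⇒∣ 2≡0))
    where
    x²≡-1 : + x * + x ≡ -1ℤ mod P
    x²≡-1 = mod-trans (mod-reflexive (sym (ℤ.pos-* x x))) (mod-trans (m≡m%p (x ℕ.* x))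
              (mod-trans (mod-reflexive (cong +_ (ℕ.≡ᵇ⇒≡ _ _ x-root))) (≡-mod 1ℤ (identity (+ (h ℕ.+ h))))))
      where identity : ∀ x → x ≡ -1ℤ + 1ℤ * (1ℤ + x)
            identity = solve-∀
    0<x : 0 < x
    0<x = nonzero x x-root
      where nonzero : ∀ y → T (-1-residue y) → 0 < y
            nonzero (suc _) _ = s≤s z≤n
    -1≡1 : -1ℤ ≡ 1ℤ mod P
    -1≡1 = begin
      -1ℤ                   ≡⟨ odd ⟨
      -1ℤ ^ h               ≈⟨ ^-cong h x²≡-1 ⟨
      (+ x * + x) ^ h       ≡⟨ ^-double (+ x) h ⟨
      (+ x) ^ (h ℕ.+ h)     ≈⟨ fermat-unit 0<x (∈-upTo⁻ x∈upTo) ⟩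
      1ℤ                    ∎
      where open ≡-mod-Reasoning P
    2≡0 : + 2 ≡ 0ℤ mod P
    2≡0 = sub-cong (mod-refl {a = 1ℤ}) -1≡1
    2<p : 2 < p
    2<p = s≤s (s≤s (ℕ.≤-trans (s≤s z≤n) (ℕ.m≤n+m (suc h′) h′)))

  legendre-minus-one : legendre -1ℤ p {{prime⇒nonZero prime}} ≡ -1ℤ ^ h
  legendre-minus-one = trans legendre-unfold (evaluate (any -1-residue (upTo p)) refl (-1^-cases h))
    where
    evaluate : ∀ b → any -1-residue (upTo p) ≡ b → -1ℤ ^ h ≡ 1ℤ ⊎ -1ℤ ^ h ≡ -1ℤ → (if b then 1ℤ else -1ℤ) ≡ -1ℤ ^ h
    evaluate true  _  (inj₁ even) = sym even
    evaluate true  eq (inj₂ odd)  = ⊥-elim (no-residue-if-odd odd (subst T (sym eq) tt))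
    evaluate false eq (inj₁ even) = ⊥-elim (subst T eq (residue-if-even even))
    evaluate false _  (inj₂ odd)  = sym odd

-- Imported only now: ℕ's _^_ would clash with the _^_ of ℤ opened in the modules above.
open import Data.Nat using (_^_; _∸_)
open import Data.Nat.Divisibility as ℕD using ()
open import Data.Integer.Divisibility using (_∣_)

odd⇒suc-double : ∀ n → ¬ (2 ℕD.∣ n) → Σ[ m ∈ ℕ ] n ≡ suc (m ℕ.+ m)
odd⇒suc-double zero          2∤0   = ⊥-elim (2∤0 (ℕD.divides 0 refl))
odd⇒suc-double (suc zero)    _     = 0 , refl
odd⇒suc-double (suc (suc n)) 2∤n+2 with odd⇒suc-double n 2∤n
  where
  2∤n : ¬ (2 ℕD.∣ n)
  2∤n (ℕD.divides q n≡2q) = 2∤n+2 (ℕD.divides (suc q) (cong (suc ∘′ suc) n≡2q))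
... | m , refl = suc m , cong suc (sym (ℕ.+-suc (suc m) m))

odd-prime-form : ∀ p → Prime p → ¬ (2 ℕD.∣ p) → Σ[ h′ ∈ ℕ ] p ≡ suc (suc h′ ℕ.+ suc h′)
odd-prime-form p p-prime 2∤p with odd⇒suc-double p 2∤p
... | zero   , refl = ⊥-elim (ℕ.nonTrivial⇒≢1 {{prime⇒nonTrivial p-prime}} refl)
... | suc h′ , refl = h′ , refl

lemma2p2 : (p : ℕ) → (pp : Prime p) → ¬ (2 ℕD.∣ p) →
    (+ (p ^ 2)) ∣ ((+ sumFrom1 (p ∸ 1) S) ℤ.- ((+ 2) ℤ.* legendre (ℤ.- (+ 1)) p {{prime⇒nonZero pp}} ℤ.- (+ (2 ^ p))))
lemma2p2 p pp 2∤p with odd-prime-form p pp 2∤p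
... | h′ , refl = subst (ℕD._∣ ℤ.∣ difference ∣) (cong (p ℕ.*_) (sym (ℕ.*-identityʳ p))) (≡0-mod⇒∣ difference≡0)
  where
  open OddPrime (suc h′) pp using (P; partial-∑-S)
  open LegendreMinusOne h′ pp using (legendre-minus-one)
  open ≡-mod-Reasoning (P ℤ.* P)
  difference expected : ℤ
  difference = + sumFrom1 (p ∸ 1) S ℤ.- (+ 2 ℤ.* legendre (ℤ.- (+ 1)) p {{prime⇒nonZero pp}} ℤ.- + (2 ^ p))
  expected = + 2 ℤ.* -1ℤ ℤ.^ suc h′ ℤ.- + (2 ^ p)
  difference≡0 : difference ≡ 0ℤ mod (P ℤ.* P)
  difference≡0 = begin
    difference                        ≡⟨ cong (λ l → + sumFrom1 (p ∸ 1) S ℤ.- (+ 2 ℤ.* l ℤ.- + (2 ^ p))) legendre-minus-one ⟩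
    + sumFrom1 (p ∸ 1) S ℤ.- expected ≈⟨ sub-cong partial-∑-S (mod-refl {a = expected}) ⟩
    expected ℤ.- expected             ≡⟨ ℤ.+-inverseʳ expected ⟩
    0ℤ                                ∎
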